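{- Let $\mathcal E$ be an exchangeability system for a noncommutative probability space $(\mathcal A,\phi)$ and let $X_{i,j}\in\mathcal A$ for $i\in[m]$, $j\in[n_i]$; put $n=n_1+\dots+n_m$ and identify $[n]$ with $\{(i,j):i\in[m],j\in[n_i]\}$ ordered lexicographically. Then $$K_m\Bigl(\prod_{j=1}^{n_1}X_{1,j},\prod_{j=1}^{n_2}X_{2,j},\dots,\prod_{j=1}^{n_m}X_{m,j}\Bigr)=\sum_{\substack{\sigma\in\Pi_n\\ \sigma\ \text{indecomposable}}}K_\sigma(X_{1,1},\dots,X_{1,n_1},X_{2,1},\dots,X_{m,n_m}),$$ where the products are ordered by increasing $j$.
   Context: A noncommutative probability space is a pair $(\mathcal A,\phi)$ of a complex unital algebra $\mathcal A$ and a unital linear functional $\phi$. An exchangeability system $\mathcal E$ for $(\mathcal A,\phi)$ consists of a noncommutative probability space $(\mathcal U,\tilde\phi)$ and embeddings (injective unital homomorphisms) $\iota_k:\mathcal A\to\mathcal U$, $k\in\mathbb N$, with $\tilde\phi\circ\iota_k=\phi$; write $X^{(k)}=\iota_k(X)$. It is required that for all $n$, all $X_1,\dots,X_n\in\mathcal A$, all indices $i_1,\dots,i_n\in\mathbb N$ and every permutation $\sigma$ of $\mathbb N$: $\tilde\phi(X_1^{(i_1)}\cdots X_n^{(i_n)})=\tilde\phi(X_1^{(\sigma(i_1))}\cdots X_n^{(\sigma(i_n))})$. Thus this value depends only on the kernel of $j\mapsto i_j$; for a set partition $\sigma$ of $[n]$ denote it $\phi_\sigma(X_1,\dots,X_n)$.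 $\Pi_n$ is the lattice of set partitions of $[n]$ under refinement, with join $\vee$ and Möbius function $\mu$. The cumulant is $K_m(Y_1,\dots,Y_m)=\frac1m\tilde\phi(Y_1^\omega\cdots Y_m^\omega)$ with $\omega$ a primitive $m$-th root of unity and $Y_j^\omega=\sum_{k=1}^m\omega^kY_j^{(k)}$; the partitioned cumulant is $K_\sigma=\sum_{\tau\le\sigma}\phi_\tau\,\mu(\tau,\sigma)$. Every $\pi\in\Pi_m$ induces $\tilde\pi\in\Pi_n$ whose blocks are $\tilde B=\{(i,j):i\in B,j\in[n_i]\}$ for $B\in\pi$; in particular $\tilde{\hat0}_m$ has the interval blocks $\{(i,j):j\in[n_i]\}$, $i\in[m]$, and $\tilde{\hat1}_m=\hat1_n$. A partition $\sigma\in\Pi_n$ is indecomposable if $\sigma\vee\tilde{\hat0}_m=\hat1_n$. -}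

module Defs where

open import Level using (0ℓ)
open import Algebra.Bundles using (CommutativeRing; Ring)
open import Data.Nat as ℕ using (ℕ; zero; suc)
open import Data.Fin as Fin using (Fin; zero; suc; toℕ)
open import Data.Fin.Properties using (all?) renaming (_≟_ to _≟ᶠ_; _≤?_ to _≤?ᶠ_)
open import Data.List as List using (List; []; _∷_; map; concatMap; filter; allFin; tabulate; length; lookup)
open import Data.List.Relation.Unary.All as All using (All)
open import Data.Product using (Σ; _×_; _,_; proj₁; proj₂)
open import Relation.Nullary using (¬_; Dec; does)
open import Relation.Nullary.Decidable using (_×-dec_; _→-dec_; ¬?)
open import Relation.Binary.PropositionalEquality using (_≡_)
open import Function.Bundles using (_↔_; Inverse)
open import Data.Bool using (if_then_else_)

-- A partition is represented by a labelling p : Fin n → Fin n; its blocks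
-- are the fibres of p.  A labelling is *canonical* if every element is
-- labelled by the least element of its block; canonical labellings are in
-- bijection with set partitions of [n], so Π n below enumerates Π_n
-- exactly once each.

Labelling : ℕ → ℕ → Set
Labelling n k = Fin n → Fin k

-- refinement order on (kernels of) labellings:  f ≼ g  iff  ker f ⊆ ker g,
-- i.e. the partition of f refines the partition of g.
_≼_ : ∀ {n a b} → Labelling n a → Labelling n b → Set
f ≼ g = ∀ x y → f x ≡ f y → g x ≡ g y

_≼?_ : ∀ {n a b} (f : Labelling n a) (g : Labelling n b) → Dec (f ≼ g)
f ≼? g = all? λ x → all? λ y → (f x ≟ᶠ f y) →-dec (g x ≟ᶠ g y)

Canonical : ∀ {n} → Labelling n n → Set
Canonical {n} p = ∀ j → (p j Fin.≤ j) × (p (p j) ≡ p j)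

Canonical? : ∀ {n} (p : Labelling n n) → Dec (Canonical p)
Canonical? p = all? λ j → (p j ≤?ᶠ j) ×-dec (p (p j) ≟ᶠ p j)

cons : ∀ {n k} → Fin k → Labelling n k → Labelling (suc n) k
cons c f zero    = c
cons c f (suc i) = f i

allFuns : (n k : ℕ) → List (Labelling n k)
allFuns zero    k = (λ ()) ∷ []
allFuns (suc n) k = concatMap (λ f → map (λ c → cons c f) (allFin k)) (allFuns n k)

Π : (n : ℕ) → List (Labelling n n)
Π n = filter Canonical? (allFuns n n)

IsOne : ∀ {n} → Labelling n n → Set
IsOne p = ∀ x y → p x ≡ p y

-- σ ∨ ρ = 1̂_n  (ρ any labelling, e.g. the interval partition ~0̂_m):
-- the least upper bound of σ and ρ in Π_n is 1̂_n, i.e. every common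
-- upper bound π ∈ Π_n of σ and ρ is 1̂_n.
JoinIsOne : ∀ {n a} → Labelling n n → Labelling n a → Set
JoinIsOne {n} σ ρ = All (λ π → σ ≼ π → ρ ≼ π → IsOne π) (Π n)

JoinIsOne? : ∀ {n a} (σ : Labelling n n) (ρ : Labelling n a) → Dec (JoinIsOne σ ρ)
JoinIsOne? {n} σ ρ = All.all? (λ π → (σ ≼? π) →-dec (ρ ≼? π) →-dec
                       all? λ x → all? λ y → π x ≟ᶠ π y) (Π n)

-- Noncommutative probability spaces over a scalar commutative ring K
-- (for the paper, K = ℂ).

module Over (K : CommutativeRing 0ℓ 0ℓ) where
  module K = CommutativeRing K
  open K using () renaming (Carrier to 𝕂)

  sumK : List 𝕂 → 𝕂
  sumK = List.foldr K._+_ K.0#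

  powK : 𝕂 → ℕ → 𝕂
  powK x zero    = K.1#
  powK x (suc k) = x K.* powK x k

  natK : ℕ → 𝕂
  natK zero    = K.0#
  natK (suc k) = K.1# K.+ natK k

  IsFieldChar0 : Set
  IsFieldChar0 = (¬ (K.1# K.≈ K.0#))
               × (∀ x → ¬ (x K.≈ K.0#) → Σ 𝕂 λ y → x K.* y K.≈ K.1#)
               × (∀ k → ¬ (natK (suc k) K.≈ K.0#))

  PrimitiveRoot : ℕ → 𝕂 → Set
  PrimitiveRoot m ω = (powK ω m K.≈ K.1#)
                    × (∀ k → 0 ℕ.< k → k ℕ.< m → ¬ (powK ω k K.≈ K.1#))

  record UAlg : Set₁ where
    field
      ring : Ring 0ℓ 0ℓ
    open Ring ring public
    field
      _·_       : 𝕂 → Carrier → Carrier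
      ·-cong    : ∀ {a b x y} → a K.≈ b → x ≈ y → (a · x) ≈ (b · y)
      ·-distribˡ : ∀ a x y → (a · (x + y)) ≈ ((a · x) + (a · y))
      ·-distribʳ : ∀ a b x → ((a K.+ b) · x) ≈ ((a · x) + (b · x))
      ·-assoc   : ∀ a b x → ((a K.* b) · x) ≈ (a · (b · x))
      ·-identity : ∀ x → (K.1# · x) ≈ x
      ·-*ˡ      : ∀ a x y → ((a · x) * y) ≈ (a · (x * y))
      ·-*ʳ      : ∀ a x y → (x * (a · y)) ≈ (a · (x * y))

    prod : List Carrier → Carrier
    prod = List.foldr _*_ 1#

    sum : List Carrier → Carrier
    sum = List.foldr _+_ 0#

  open UAlg using (Carrier)

  record UFunctional (A : UAlg) : Set where
    private module A = UAlg A
    field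
      φ       : A.Carrier → 𝕂
      φ-cong  : ∀ {x y} → x A.≈ y → φ x K.≈ φ y
      φ-+     : ∀ x y → φ (x A.+ y) K.≈ (φ x K.+ φ y)
      φ-·     : ∀ a x → φ (a A.· x) K.≈ (a K.* φ x)
      φ-1     : φ A.1# K.≈ K.1#

  record Embedding (A B : UAlg) : Set where
    private
      module A = UAlg A
      module B = UAlg B
    field
      f      : A.Carrier → B.Carrier
      f-cong : ∀ {x y} → x A.≈ y → f x B.≈ f y
      f-+    : ∀ x y → f (x A.+ y) B.≈ (f x B.+ f y)
      f-*    : ∀ x y → f (x A.* y) B.≈ (f x B.* f y)
      f-·    : ∀ a x → f (a A.· x) B.≈ (a B.· f x)
      f-1    : f A.1# B.≈ B.1#
      f-inj  : ∀ {x y} → f x B.≈ f y → x A.≈ y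

  record ExchSystem (A : UAlg) (φ : UFunctional A) : Set₁ where
    private module A = UAlg A
    field
      U  : UAlg
      φ̃  : UFunctional U
      ι  : ℕ → Embedding A U
    private module U = UAlg U
    _^⟨_⟩ : A.Carrier → ℕ → U.Carrier
    X ^⟨ k ⟩ = Embedding.f (ι k) X
    field
      φ̃∘ι : ∀ k x → UFunctional.φ φ̃ (x ^⟨ k ⟩) K.≈ UFunctional.φ φ x
      exchangeable : ∀ n (X : Fin n → A.Carrier) (i : Fin n → ℕ) (σ : ℕ ↔ ℕ) →
        UFunctional.φ φ̃ (U.prod (tabulate λ j → X j ^⟨ i j ⟩))
          K.≈ UFunctional.φ φ̃ (U.prod (tabulate λ j → X j ^⟨ Inverse.to σ (i j) ⟩))

    φ̃′ : U.Carrier → 𝕂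
    φ̃′ = UFunctional.φ φ̃

    -- φ_σ(X_1,…,X_n): value on any index map with kernel σ
    -- (here the index map j ↦ σ j itself)
    φPart : ∀ {n} → Labelling n n → (Fin n → A.Carrier) → 𝕂
    φPart {n} σ X = φ̃′ (U.prod (tabulate λ j → X j ^⟨ toℕ (σ j) ⟩))

    -- K_m(Y_1,…,Y_m) = (1/m) φ̃(Y_1^ω ⋯ Y_m^ω), Y^ω = Σ_{k=1}^m ω^k Y^(k);
    -- minv is 1/m
    cumulant : (m : ℕ) (ω minv : 𝕂) → (Fin m → A.Carrier) → 𝕂
    cumulant m ω minv Y =
      minv K.* φ̃′ (U.prod (tabulate λ j →
        U.sum (map (λ k → powK ω k U.· (Y j ^⟨ k ⟩)) (List.map suc (List.upTo m)))))

  -- The fuel argument bounds the length of chains; fuel n is sufficient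
  -- since chains in Π_n have length < n.
  μFuel : ∀ {n} → ℕ → Labelling n n → Labelling n n → 𝕂
  μFuel {n} fuel τ σ with does (σ ≼? τ)
  ... | Data.Bool.true = K.1#
  μFuel {n} zero τ σ | Data.Bool.false = K.0#
  μFuel {n} (suc fuel) τ σ | Data.Bool.false =
    K.- sumK (map (μFuel fuel τ)
      (filter (λ ρ → (τ ≼? ρ) ×-dec (ρ ≼? σ) ×-dec ¬? (σ ≼? ρ)) (Π n)))

  μ : ∀ {n} → Labelling n n → Labelling n n → 𝕂
  μ {n} = μFuel n

  Kpart : ∀ {A φ} (E : ExchSystem A φ) {n} → Labelling n n → (Fin n → Carrier A) → 𝕂
  Kpart E {n} σ X = sumK (map (λ τ → ExchSystem.φPart E τ X K.* μ τ σ)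
                              (filter (λ τ → τ ≼? σ) (Π n)))

  module Flatten (A : UAlg) (m : ℕ) (ns : Fin m → ℕ)
                 (X : (i : Fin m) → Fin (ns i) → Carrier A) where
    pairs : List (Fin m × Carrier A)
    pairs = concatMap (λ i → tabulate (λ j → (i , X i j))) (allFin m)

    n : ℕ
    n = length pairs

    Xflat : Fin n → Carrier A
    Xflat k = proj₂ (lookup pairs k)

    interval : Labelling n m
    interval k = proj₁ (lookup pairs k)

    Indecomposable : Labelling n n → Set
    Indecomposable σ = JoinIsOne σ interval

    Indecomposable? : (σ : Labelling n n) → Dec (Indecomposable σ)
    Indecomposable? σ = JoinIsOne? σ interval

    rowProd : Fin m → Carrier A
    rowProd i = UAlg.prod A (tabulate (X i))

-- Expanding Y^ω = Σ_c ω^c Y^(c) in K_m(Y_1,…,Y_m) = m⁻¹ φ̃(Y_1^ω ⋯ Y_m^ω), with Y_i the row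
-- products, gives m⁻¹ Σ_k w(k) φ̃(∏_i Y_i^(k_i)) over all k : [m] → [m], where w(k) = ∏_i ω^(k_i).
-- By exchangeability each term is φ_τ for τ the kernel of (i,j) ↦ k_i, so K_m = Σ_τ c(τ) φ_τ.
-- Möbius inversion on Π_n rewrites this as Σ_σ g(σ) K_σ with g(σ) = Σ_{ρ ≥ σ} c(ρ), and
-- g(σ) = m⁻¹ Σ_{σ ≤ ker(k ∘ row)} w(k) is the indicator of indecomposability: if σ ∨ 0̃_m = 1̂ only
-- constant k qualify and contribute m⁻¹ Σ_c ω^(cm) = 1; otherwise rotating k cyclically on the
-- rows of one block of σ ∨ 0̃_m permutes the admissible k and multiplies w by ω^r with 0 < r < m,
-- so the sum vanishes.

module Submission where

open import Defs
open import Level using (Level; 0ℓ)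
open import Algebra.Bundles using (CommutativeMonoid; Ring; CommutativeRing)
open import Data.Nat as ℕ using (ℕ; zero; suc; _≤_; _<_; z≤n; s≤s)
import Data.Nat.Properties as ℕ
open import Data.Fin as Fin using (Fin; zero; suc; toℕ; fromℕ; inject₁)
import Data.Fin.Properties as Fin
open import Data.Fin.Subset as Subset using (Subset; ∣_∣; _⊆_)
import Data.Fin.Subset.Properties as Subset
open import Data.List as List using (List; []; _∷_; _++_; map; concatMap; filter; allFin; tabulate; foldr)
import Data.List.Properties as List
open import Data.List.Membership.Propositional using (_∈_)
open import Data.List.Membership.Propositional.Properties using (∈-filter⁻; ∈-filter⁺; ∈-map⁺; ∈-concat⁺′; ∈-allFin; ∈-tabulate⁺)
open import Data.List.Relation.Unary.Any using (here; there; satisfied; index)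
open import Data.List.Relation.Unary.Any.Properties using (lookup-index)
import Data.List.Relation.Unary.All as All
open import Data.List.Relation.Unary.All.Properties using (¬All⇒Any¬)
import Data.Vec as Vec
open import Data.Vec using ([]; _∷_)
import Data.Vec.Properties as Vec
open import Data.Bool using (true; false; if_then_else_)
open import Data.Product using (∃; _×_; _,_; proj₁; proj₂)
open import Data.Empty using (⊥-elim)
open import Function using (_∘_; id; _⇔_; mk⇔; Equivalence; _↔_; mk↔ₛ′)
import Function.Properties.Equivalence as ⇔
open import Function.Related.TypeIsomorphisms using (¬-cong-⇔)
open import Data.Product.Function.NonDependent.Propositional using (_×-⇔_)
open import Relation.Binary.Core using (_Preserves_⟶_)
open import Relation.Nullary using (¬_; Dec; does; yes; no)
open import Relation.Nullary.Decidable using (_×-dec_; _→-dec_; ¬?; toWitness; dec-true; dec-false; isYes≗does; does-⇔)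
open import Data.Bool.Properties using (T-≡)
open import Relation.Unary using (Pred; Decidable)
open import Relation.Binary.PropositionalEquality as ≡ using (_≡_; _≢_; _≗_)

cyclicPred : ∀ {k} → Fin (suc k) → Fin (suc k)
cyclicPred zero    = fromℕ _
cyclicPred (suc i) = inject₁ i

cyclicPred-injective : ∀ {k} {c d : Fin (suc k)} → cyclicPred c ≡ cyclicPred d → c ≡ d
cyclicPred-injective {c = zero}  {zero}  _ = ≡.refl
cyclicPred-injective {c = zero}  {suc d} e = ⊥-elim (Fin.fromℕ≢inject₁ e)
cyclicPred-injective {c = suc c} {zero}  e = ⊥-elim (Fin.fromℕ≢inject₁ (≡.sym e))
cyclicPred-injective {c = suc c} {suc d} e = ≡.cong suc (Fin.inject₁-injective e)

applyUpTo≡map-allFin : ∀ {B : Set} (f : ℕ → B) n → List.applyUpTo f n ≡ map (f ∘ toℕ) (allFin n)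
applyUpTo≡map-allFin f zero    = ≡.refl
applyUpTo≡map-allFin f (suc n) = ≡.cong (f 0 ∷_) (≡.trans (applyUpTo≡map-allFin (f ∘ suc) n)
  (≡.trans (List.map-tabulate id (f ∘ suc ∘ toℕ)) (≡.sym (List.map-tabulate suc (f ∘ toℕ)))))

module ListSum {c ℓ} (M : CommutativeMonoid c ℓ) where
  open CommutativeMonoid M
  open import Relation.Binary.Reasoning.Setoid setoid
  open import Algebra.Properties.CommutativeSemigroup commutativeSemigroup using (interchange)

  ∑ : {X : Set} → List X → (X → Carrier) → Carrier
  ∑ L F = foldr _∙_ ε (map F L)

  syntax ∑ L (λ x → F) = ∑[ x ∈ L ] F

  ∑-cong-∈ : {X : Set} (L : List X) {F G : X → Carrier} → (∀ {x} → x ∈ L → F x ≈ G x) → ∑ L F ≈ ∑ L G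
  ∑-cong-∈ []      e = refl
  ∑-cong-∈ (x ∷ L) e = ∙-cong (e (here ≡.refl)) (∑-cong-∈ L (e ∘ there))

  ∑-cong : {X : Set} (L : List X) {F G : X → Carrier} → (∀ x → F x ≈ G x) → ∑ L F ≈ ∑ L G
  ∑-cong L e = ∑-cong-∈ L (λ {x} _ → e x)

  ∑-++ : {X : Set} (L L′ : List X) (F : X → Carrier) → ∑ (L ++ L′) F ≈ ∑ L F ∙ ∑ L′ F
  ∑-++ []      L′ F = sym (identityˡ _)
  ∑-++ (x ∷ L) L′ F = trans (∙-cong refl (∑-++ L L′ F)) (sym (assoc _ _ _))

  ∑-map : {X Y : Set} (g : X → Y) (L : List X) (F : Y → Carrier) → ∑ (map g L) F ≡ ∑ L (F ∘ g)
  ∑-map g L F = ≡.cong (foldr _∙_ ε) (≡.sym (List.map-∘ L))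

  ∑-concatMap : {X Y : Set} (g : X → List Y) (L : List X) (F : Y → Carrier) →
    ∑ (concatMap g L) F ≈ ∑[ x ∈ L ] ∑ (g x) F
  ∑-concatMap g []      F = refl
  ∑-concatMap g (x ∷ L) F = trans (∑-++ (g x) (concatMap g L) F) (∙-cong refl (∑-concatMap g L F))

  ∑-ε : {X : Set} (L : List X) → ∑[ x ∈ L ] ε ≈ ε
  ∑-ε []      = refl
  ∑-ε (x ∷ L) = trans (identityˡ _) (∑-ε L)

  ∑-≈ε : {X : Set} (L : List X) {F : X → Carrier} → (∀ x → F x ≈ ε) → ∑ L F ≈ ε
  ∑-≈ε L e = trans (∑-cong L e) (∑-ε L)

  ∑-∙ : {X : Set} (L : List X) (F G : X → Carrier) → ∑[ x ∈ L ] (F x ∙ G x) ≈ ∑ L F ∙ ∑ L G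
  ∑-∙ []      F G = sym (identityˡ _)
  ∑-∙ (x ∷ L) F G = trans (∙-cong refl (∑-∙ L F G)) (interchange _ _ _ _)

  ∑-comm : {X Y : Set} (L : List X) (L′ : List Y) (F : X → Y → Carrier) →
    ∑[ x ∈ L ] ∑[ y ∈ L′ ] F x y ≈ ∑[ y ∈ L′ ] ∑[ x ∈ L ] F x y
  ∑-comm []      L′ F = sym (∑-ε L′)
  ∑-comm (x ∷ L) L′ F = trans (∙-cong refl (∑-comm L L′ F)) (sym (∑-∙ L′ (F x) _))

  ∑-allFin-suc : ∀ {k} (G : Fin (suc k) → Carrier) → ∑ (allFin (suc k)) G ≈ G zero ∙ ∑ (allFin k) (G ∘ suc)
  ∑-allFin-suc G = ∙-cong refl (reflexive (≡.cong (foldr _∙_ ε)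
    (≡.trans (List.map-tabulate suc G) (≡.sym (List.map-tabulate id (G ∘ suc))))))

  ∑-allFuns-suc : ∀ {n k} (F : Labelling (suc n) k → Carrier) →
    ∑ (allFuns (suc n) k) F ≈ ∑[ f ∈ allFuns n k ] ∑[ c ∈ allFin k ] F (cons c f)
  ∑-allFuns-suc {n} {k} F = trans (∑-concatMap _ (allFuns n k) F)
    (∑-cong (allFuns n k) (λ f → reflexive (∑-map (λ c → cons c f) (allFin k) F)))

  ∑-allFin-last : ∀ {k} (G : Fin (suc k) → Carrier) → ∑ (allFin (suc k)) G ≈ ∑ (allFin k) (G ∘ inject₁) ∙ G (fromℕ k)
  ∑-allFin-last {zero}  G = comm _ _
  ∑-allFin-last {suc k} G = begin
    ∑ (allFin (suc (suc k))) G                                         ≈⟨ ∑-allFin-suc G ⟩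
    G zero ∙ ∑ (allFin (suc k)) (G ∘ suc)                               ≈⟨ ∙-cong refl (∑-allFin-last (G ∘ suc)) ⟩
    G zero ∙ (∑ (allFin k) (G ∘ suc ∘ inject₁) ∙ G (fromℕ (suc k)))   ≈⟨ assoc _ _ _ ⟨
    (G zero ∙ ∑ (allFin k) (G ∘ suc ∘ inject₁)) ∙ G (fromℕ (suc k))   ≈⟨ ∙-cong (∑-allFin-suc (G ∘ inject₁)) refl ⟨
    ∑ (allFin (suc k)) (G ∘ inject₁) ∙ G (fromℕ (suc k)) ∎

  ∑-cyclicPred : ∀ {k} (G : Fin (suc k) → Carrier) → ∑ (allFin (suc k)) (G ∘ cyclicPred) ≈ ∑ (allFin (suc k)) G
  ∑-cyclicPred {k} G = begin
    ∑ (allFin (suc k)) (G ∘ cyclicPred)            ≈⟨ ∑-allFin-suc (G ∘ cyclicPred) ⟩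
    G (fromℕ k) ∙ ∑ (allFin k) (G ∘ inject₁)        ≈⟨ comm _ _ ⟩
    ∑ (allFin k) (G ∘ inject₁) ∙ G (fromℕ k)        ≈⟨ ∑-allFin-last G ⟨
    ∑ (allFin (suc k)) G ∎

  ∑-allFuns-reindex : ∀ {d M} (g : Fin d → Fin M → Fin M) →
    (∀ i (G : Fin M → Carrier) → ∑ (allFin M) (G ∘ g i) ≈ ∑ (allFin M) G) →
    (F : Labelling d M → Carrier) → F Preserves _≗_ ⟶ _≈_ →
    ∑[ k ∈ allFuns d M ] F (λ i → g i (k i)) ≈ ∑ (allFuns d M) F
  ∑-allFuns-reindex {zero}      g g-sum F F-resp = ∙-cong (F-resp (λ ())) refl
  ∑-allFuns-reindex {suc d} {M} g g-sum F F-resp = begin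
    ∑[ k ∈ allFuns (suc d) M ] F (λ i → g i (k i))
      ≈⟨ ∑-allFuns-suc (λ k → F (λ i → g i (k i))) ⟩
    ∑[ f ∈ allFuns d M ] ∑[ c ∈ allFin M ] F (λ i → g i (cons c f i))
      ≈⟨ ∑-cong (allFuns d M) (λ f → ∑-cong (allFin M) λ c → F-resp λ { zero → ≡.refl ; (suc i) → ≡.refl }) ⟩
    ∑[ f ∈ allFuns d M ] ∑[ c ∈ allFin M ] F (cons (g zero c) (λ i → g (suc i) (f i)))
      ≈⟨ ∑-cong (allFuns d M) (λ f → g-sum zero (λ c → F (cons c (λ i → g (suc i) (f i))))) ⟩
    ∑[ f ∈ allFuns d M ] ∑[ c ∈ allFin M ] F (cons c (λ i → g (suc i) (f i)))
      ≈⟨ ∑-allFuns-reindex (g ∘ suc) (g-sum ∘ suc) (λ f → ∑[ c ∈ allFin M ] F (cons c f))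
           (λ e → ∑-cong (allFin M) λ c → F-resp λ { zero → ≡.refl ; (suc i) → e i }) ⟩
    ∑[ f ∈ allFuns d M ] ∑[ c ∈ allFin M ] F (cons c f)
      ≈⟨ ∑-allFuns-suc F ⟨
    ∑ (allFuns (suc d) M) F ∎

module RingSum {c ℓ} (R : Ring c ℓ) where
  open Ring R
  open ListSum +-commutativeMonoid public

  ∑-distribˡ : {X : Set} (L : List X) (a : Carrier) (F : X → Carrier) → a * ∑ L F ≈ ∑[ x ∈ L ] (a * F x)
  ∑-distribˡ []      a F = zeroʳ a
  ∑-distribˡ (x ∷ L) a F = trans (distribˡ _ _ _) (+-cong refl (∑-distribˡ L a F))

  ∑-distribʳ : {X : Set} (L : List X) (a : Carrier) (F : X → Carrier) → ∑ L F * a ≈ ∑[ x ∈ L ] (F x * a)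
  ∑-distribʳ []      a F = zeroˡ a
  ∑-distribʳ (x ∷ L) a F = trans (distribʳ _ _ _) (+-cong refl (∑-distribʳ L a F))

  when : ∀ {p} {Q : Set p} → Dec Q → Carrier → Carrier
  when d x = if does d then x else 0#

  module _ {p} {Q : Set p} where

    when-cong : (d : Dec Q) {x y : Carrier} → (Q → x ≈ y) → when d x ≈ when d y
    when-cong (yes q) e = e q
    when-cong (no _)  e = refl

    when-yes : (d : Dec Q) (x : Carrier) → Q → when d x ≈ x
    when-yes (yes _) x q = refl
    when-yes (no ¬q) x q = ⊥-elim (¬q q)

    when-no : (d : Dec Q) (x : Carrier) → ¬ Q → when d x ≈ 0#
    when-no (yes q) x ¬q = ⊥-elim (¬q q)
    when-no (no _)  x ¬q = refl

    when-*ʳ : (d : Dec Q) (x y : Carrier) → when d x * y ≈ when d (x * y)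
    when-*ʳ (yes _) x y = refl
    when-*ʳ (no _)  x y = zeroˡ y

    when-*ˡ : (d : Dec Q) (x y : Carrier) → x * when d y ≈ when d (x * y)
    when-*ˡ (yes _) x y = refl
    when-*ˡ (no _)  x y = zeroʳ x

    ∑-when : (d : Dec Q) {X : Set} (L : List X) (F : X → Carrier) → ∑[ x ∈ L ] when d (F x) ≈ when d (∑ L F)
    ∑-when (yes _) L F = refl
    ∑-when (no _)  L F = ∑-ε L

    when-split : (d : Dec Q) (x : Carrier) → x ≈ when d x + when (¬? d) x
    when-split (yes _) x = sym (+-identityʳ x)
    when-split (no _)  x = sym (+-identityˡ x)

    when-+ : (d : Dec Q) (x y : Carrier) → when d (x + y) ≈ when d x + when d y
    when-+ (yes _) x y = refl
    when-+ (no _)  x y = sym (+-identityʳ 0#)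

  when-⇔ : ∀ {p q} {Q : Set p} {R : Set q} (d : Dec Q) (e : Dec R) (x : Carrier) → Q ⇔ R → when d x ≈ when e x
  when-⇔ (yes q) e x Q⇔R = sym (when-yes e x (Equivalence.to Q⇔R q))
  when-⇔ (no ¬q) e x Q⇔R = sym (when-no e x (¬q ∘ Equivalence.from Q⇔R))

  when-× : ∀ {p q} {Q : Set p} {R : Set q} (d : Dec Q) (e : Dec R) (x : Carrier) → when (d ×-dec e) x ≈ when d (when e x)
  when-× (yes _) (yes _) x = refl
  when-× (yes _) (no _)  x = refl
  when-× (no _)  e       x = refl

  when²-⇔ : ∀ {p q r} {Q : Set p} {R : Set q} {S : Set r} (d : Dec Q) (e : Dec R) (f : Dec S) (x : Carrier) →
    (Q × R) ⇔ S → when d (when e x) ≈ when f x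
  when²-⇔ d e f x QR⇔S = trans (sym (when-× d e x)) (when-⇔ (d ×-dec e) f x QR⇔S)

  when-*-when : ∀ {p q} {Q : Set p} {R : Set q} (d : Dec Q) (e : Dec R) (x y : Carrier) →
    when d x * when e y ≈ when e (when d (x * y))
  when-*-when (yes _) (yes _) x y = refl
  when-*-when (yes _) (no _)  x y = zeroʳ x
  when-*-when (no _)  (yes _) x y = zeroˡ _
  when-*-when (no _)  (no _)  x y = zeroˡ _

  when-comm : ∀ {p q} {Q : Set p} {R : Set q} (d : Dec Q) (e : Dec R) (x : Carrier) → when d (when e x) ≈ when e (when d x)
  when-comm (yes _) (yes _) x = refl
  when-comm (yes _) (no _)  x = refl
  when-comm (no _)  (yes _) x = refl
  when-comm (no _)  (no _)  x = refl

  ∑-filter : {X : Set} {p : Level} {Q : Pred X p} (Q? : Decidable Q) (L : List X) (F : X → Carrier) →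
    ∑ (filter Q? L) F ≈ ∑[ x ∈ L ] when (Q? x) (F x)
  ∑-filter Q? []      F = refl
  ∑-filter Q? (x ∷ L) F with does (Q? x)
  ... | true  = +-cong refl (∑-filter Q? L F)
  ... | false = trans (∑-filter Q? L F) (sym (+-identityˡ _))

module Labellings where

  infix 4 _∼_ _∼?_ _≗?_

  _∼_ : ∀ {n a b} → Labelling n a → Labelling n b → Set
  f ∼ g = (f ≼ g) × (g ≼ f)

  _∼?_ : ∀ {n a b} (f : Labelling n a) (g : Labelling n b) → Dec (f ∼ g)
  f ∼? g = (f ≼? g) ×-dec (g ≼? f)

  _≗?_ : ∀ {n a} (f g : Labelling n a) → Dec (f ≗ g)
  f ≗? g = Fin.all? λ i → f i Fin.≟ g i

  cons-≗⇔ : ∀ {n a} (c : Fin a) (f : Labelling n a) (g : Labelling (suc n) a) →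
    cons c f ≗ g ⇔ (f ≗ g ∘ suc × c ≡ g zero)
  cons-≗⇔ c f g = mk⇔ (λ e → e ∘ suc , e zero) (λ { (e , e₀) zero → e₀ ; (e , e₀) (suc i) → e i })

  Constant : ∀ {n a} → Labelling n a → Set
  Constant f = ∀ i j → f i ≡ f j

  constant? : ∀ {n a} (f : Labelling n a) → Dec (Constant f)
  constant? f = Fin.all? λ i → Fin.all? λ j → f i Fin.≟ f j

  ≼-refl : ∀ {n a} {f : Labelling n a} → f ≼ f
  ≼-refl x y e = e

  ≼-trans : ∀ {n a b c} {f : Labelling n a} {g : Labelling n b} {h : Labelling n c} → f ≼ g → g ≼ h → f ≼ h
  ≼-trans f≼g g≼h x y e = g≼h x y (f≼g x y e)

  ≗⇒≼ : ∀ {n a} {f g : Labelling n a} → f ≗ g → f ≼ g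
  ≗⇒≼ f≗g x y e = ≡.trans (≡.sym (f≗g x)) (≡.trans e (f≗g y))

  ∼-trans : ∀ {n a b c} {f : Labelling n a} {g : Labelling n b} {h : Labelling n c} → f ∼ g → g ∼ h → f ∼ h
  ∼-trans (f≼g , g≼f) (g≼h , h≼g) = ≼-trans f≼g g≼h , ≼-trans h≼g g≼f

  ≗⇒∼ : ∀ {n a} {f g : Labelling n a} → f ≗ g → f ∼ g
  ≗⇒∼ f≗g = ≗⇒≼ f≗g , ≗⇒≼ (≡.sym ∘ f≗g)

  ≼-respˡ-∼ : ∀ {n a a′ b} {f : Labelling n a} {f′ : Labelling n a′} {g : Labelling n b} → f ∼ f′ → f ≼ g ⇔ f′ ≼ g
  ≼-respˡ-∼ (f≼f′ , f′≼f) = mk⇔ (≼-trans f′≼f) (≼-trans f≼f′)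

  ≼-respʳ-∼ : ∀ {n a b b′} {f : Labelling n a} {g : Labelling n b} {g′ : Labelling n b′} → g ∼ g′ → f ≼ g ⇔ f ≼ g′
  ≼-respʳ-∼ (g≼g′ , g′≼g) = mk⇔ (λ p → ≼-trans p g≼g′) (λ p → ≼-trans p g′≼g)

  ∼-respˡ-∼ : ∀ {n a a′ b} {f : Labelling n a} {f′ : Labelling n a′} {g : Labelling n b} → f ∼ f′ → f ∼ g ⇔ f′ ∼ g
  ∼-respˡ-∼ f∼f′ = ≼-respˡ-∼ f∼f′ ×-⇔ ≼-respʳ-∼ f∼f′

  ¬≼⇒separated : ∀ {n a b} (f : Labelling n a) (g : Labelling n b) → ¬ (f ≼ g) →
    ∃ λ x → ∃ λ y → f x ≡ f y × g x ≢ g y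
  ¬≼⇒separated {n} f g f⋠g
    with Fin.¬∀⟶∃¬ n _ (λ x → Fin.all? λ y → (f x Fin.≟ f y) →-dec (g x Fin.≟ g y)) f⋠g
  ... | x , ¬∀y with Fin.¬∀⟶∃¬ n _ (λ y → (f x Fin.≟ f y) →-dec (g x Fin.≟ g y)) ¬∀y
  ... | y , ¬imp with f x Fin.≟ f y | g x Fin.≟ g y
  ... | yes e | no ne = x , y , e , ne
  ... | _     | yes e = ⊥-elim (¬imp (λ _ → e))
  ... | no ne | _     = ⊥-elim (¬imp (⊥-elim ∘ ne))

  ¬JoinIsOne⇒separated : ∀ {n a} (σ : Labelling n n) (ρ : Labelling n a) → ¬ JoinIsOne σ ρ →
    ∃ λ π → σ ≼ π × ρ ≼ π × ∃ λ x → ∃ λ y → π x ≢ π y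
  ¬JoinIsOne⇒separated {n} σ ρ ¬join with satisfied (¬All⇒Any¬ upperBound⇒one? (Π n) ¬join)
    where
    upperBound⇒one? : ∀ π → Dec (σ ≼ π → ρ ≼ π → IsOne π)
    upperBound⇒one? π = (σ ≼? π) →-dec (ρ ≼? π) →-dec (Fin.all? λ x → Fin.all? λ y → π x Fin.≟ π y)
  ... | π , ¬upperBound⇒one with σ ≼? π | ρ ≼? π
  ... | no σ⋠π  | _       = ⊥-elim (¬upperBound⇒one (⊥-elim ∘ σ⋠π))
  ... | yes _   | no ρ⋠π  = ⊥-elim (¬upperBound⇒one λ _ → ⊥-elim ∘ ρ⋠π)
  ... | yes σ≼π | yes ρ≼π with ¬≼⇒separated (λ _ → zero {n = 0}) π (λ one → ¬upperBound⇒one λ _ _ x y → one x y ≡.refl)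
  ...   | x , y , _ , πx≢πy = π , σ≼π , ρ≼π , x , y , πx≢πy

  -- canon κ labels each element by the least element with the same κ-label
  canon : ∀ {n a} → Labelling n a → Labelling n n
  canon {suc n} κ zero = zero
  canon {suc n} κ (suc j) with κ zero Fin.≟ κ (suc j)
  ... | yes _ = zero
  ... | no _  = suc (canon (κ ∘ suc) j)

  canon-label : ∀ {n a} (κ : Labelling n a) j → κ (canon κ j) ≡ κ j
  canon-label {suc n} κ zero = ≡.refl
  canon-label {suc n} κ (suc j) with κ zero Fin.≟ κ (suc j)
  ... | yes e = e
  ... | no _  = canon-label (κ ∘ suc) j

  canon-≤ : ∀ {n a} (κ : Labelling n a) j → canon κ j Fin.≤ j
  canon-≤ {suc n} κ zero = z≤n
  canon-≤ {suc n} κ (suc j) with κ zero Fin.≟ κ (suc j)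
  ... | yes _ = z≤n
  ... | no _  = s≤s (canon-≤ (κ ∘ suc) j)

  canon-minimal : ∀ {n a} (κ : Labelling n a) i j → κ i ≡ κ j → canon κ j Fin.≤ i
  canon-minimal {suc n} κ i zero e = z≤n
  canon-minimal {suc n} κ i (suc j) e with κ zero Fin.≟ κ (suc j)
  canon-minimal {suc n} κ i       (suc j) e | yes _ = z≤n
  canon-minimal {suc n} κ zero    (suc j) e | no ne = ⊥-elim (ne e)
  canon-minimal {suc n} κ (suc i) (suc j) e | no ne = s≤s (canon-minimal (κ ∘ suc) i j e)

  κ≼canon : ∀ {n a} (κ : Labelling n a) → κ ≼ canon κ
  κ≼canon κ i j e = Fin.≤-antisym
    (canon-minimal κ (canon κ j) i (≡.trans (canon-label κ j) (≡.sym e)))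
    (canon-minimal κ (canon κ i) j (≡.trans (canon-label κ i) e))

  canon∼ : ∀ {n a} (κ : Labelling n a) → canon κ ∼ κ
  canon∼ κ = (λ x y e → ≡.trans (≡.sym (canon-label κ x)) (≡.trans (≡.cong κ e) (canon-label κ y))) , κ≼canon κ

  canon-canonical : ∀ {n a} (κ : Labelling n a) → Canonical (canon κ)
  canon-canonical κ j = canon-≤ κ j , κ≼canon κ _ _ (canon-label κ j)

  canonical-resp-≗ : ∀ {n} {f g : Labelling n n} → f ≗ g → Canonical g → Canonical f
  canonical-resp-≗ {f = f} {g} f≗g can j =
    ≡.subst (Fin._≤ j) (≡.sym (f≗g j)) (proj₁ (can j)) ,
    ≡.trans (f≗g (f j)) (≡.trans (≡.cong g (f≗g j)) (≡.trans (proj₂ (can j)) (≡.sym (f≗g j))))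

  canonical∼⇒≗canon : ∀ {n a} (κ : Labelling n a) {τ : Labelling n n} → Canonical τ → τ ∼ κ → τ ≗ canon κ
  canonical∼⇒≗canon κ {τ} can (τ≼κ , κ≼τ) j = Fin.≤-antisym
    (≡.subst (Fin._≤ canon κ j) (κ≼τ (canon κ j) j (canon-label κ j)) (proj₁ (can (canon κ j))))
    (canon-minimal κ (τ j) j (τ≼κ _ _ (proj₂ (can j))))

  ≗canon⇔canonical∼ : ∀ {n a} (κ : Labelling n a) {τ : Labelling n n} → τ ≗ canon κ ⇔ (Canonical τ × τ ∼ κ)
  ≗canon⇔canonical∼ κ = mk⇔
    (λ τ≗ → canonical-resp-≗ τ≗ (canon-canonical κ) , ∼-trans (≗⇒∼ τ≗) (canon∼ κ))
    (λ (can , τ∼κ) → canonical∼⇒≗canon κ can τ∼κ)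

  canonical⇒≗canon : ∀ {n} {τ : Labelling n n} → Canonical τ → τ ≗ canon τ
  canonical⇒≗canon {τ = τ} can = canonical∼⇒≗canon τ can (≼-refl , ≼-refl)

  allFuns-complete : ∀ {n k} (g : Labelling n k) → ∃ λ f → f ∈ allFuns n k × f ≗ g
  allFuns-complete {zero} g = (λ ()) , here ≡.refl , (λ ())
  allFuns-complete {suc n} {k} g with allFuns-complete (g ∘ suc)
  ... | f , f∈ , f≗ = cons (g zero) f ,
      ∈-concat⁺′ (∈-map⁺ (λ c → cons c f) (∈-allFin (g zero))) (∈-map⁺ (λ f → map (λ c → cons c f) (allFin k)) f∈) ,
      λ { zero → ≡.refl ; (suc i) → f≗ i }

  ∈Π⇒canonical : ∀ {n} {τ : Labelling n n} → τ ∈ Π n → Canonical τ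
  ∈Π⇒canonical {n} = proj₂ ∘ ∈-filter⁻ Canonical? {xs = allFuns n n}

  canon∈Π : ∀ {n a} (κ : Labelling n a) → ∃ λ τ → τ ∈ Π n × τ ≗ canon κ
  canon∈Π κ with allFuns-complete (canon κ)
  ... | τ , τ∈ , τ≗ = τ , ∈-filter⁺ Canonical? τ∈ (canonical-resp-≗ τ≗ (canon-canonical κ)) , τ≗

module Subsets where

  subsetOf : ∀ {n p} {Q : Pred (Fin n) p} → Decidable Q → Subset n
  subsetOf Q? = Vec.tabulate (does ∘ Q?)

  ∈-subsetOf : ∀ {n p} {Q : Pred (Fin n) p} (Q? : Decidable Q) {x} → x Subset.∈ subsetOf Q? ⇔ Q x
  ∈-subsetOf Q? {x} = mk⇔
    (λ x∈ → toWitness {a? = Q? x} (Equivalence.from T-≡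
      (≡.trans (isYes≗does (Q? x)) (≡.trans (≡.sym (Vec.lookup∘tabulate (does ∘ Q?) x)) (Vec.[]=⇒lookup x∈)))))
    (λ q → Vec.lookup⇒[]= x _ (≡.trans (Vec.lookup∘tabulate (does ∘ Q?) x) (dec-true (Q? x) q)))

  ∈⇒∣∣-pos : ∀ {n} {p : Subset n} {x} → x Subset.∈ p → 0 < ∣ p ∣
  ∈⇒∣∣-pos x∈p = ℕ.≤-trans (s≤s z≤n) (Subset.x∈p⇒∣p-x∣<∣p∣ x∈p)

  ∉⇒∣∣<n : ∀ {n} {p : Subset n} {x} → x Subset.∉ p → ∣ p ∣ < n
  ∉⇒∣∣<n {p = p} x∉p = ℕ.≤∧≢⇒< (Subset.∣p∣≤n p) (λ e → x∉p (≡.subst (_ Subset.∈_) (≡.sym (Subset.∣p∣≡n⇒p≡⊤ e)) Subset.∈⊤))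

module Blocks where
  open Labellings
  open Subsets

  -- for canonical τ the fixed points are the least elements of the blocks, one per block
  leaders : ∀ {n} → Labelling n n → Subset n
  leaders τ = subsetOf (λ j → τ j Fin.≟ j)

  ∈-leaders : ∀ {n} (τ : Labelling n n) {j} → j Subset.∈ leaders τ ⇔ τ j ≡ j
  ∈-leaders τ = ∈-subsetOf (λ j → τ j Fin.≟ j)

  blockCount : ∀ {n} → Labelling n n → ℕ
  blockCount τ = ∣ leaders τ ∣

  blockCount-≤ : ∀ {n} (τ : Labelling n n) → blockCount τ ≤ n
  blockCount-≤ τ = Subset.∣p∣≤n (leaders τ)

  blockCount-pos : ∀ {n} {τ : Labelling (suc n) (suc n)} → Canonical τ → 0 < blockCount τ
  blockCount-pos {τ = τ} can = ∈⇒∣∣-pos (Equivalence.from (∈-leaders τ) (Fin.≤-antisym (proj₁ (can zero)) z≤n))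

  blockCount-< : ∀ {n} {τ σ : Labelling n n} → Canonical τ → Canonical σ → τ ≼ σ → ¬ (σ ≼ τ) →
    blockCount σ < blockCount τ
  blockCount-< {τ = τ} {σ} cτ cσ τ≼σ σ⋠τ with ¬≼⇒separated σ τ σ⋠τ
  ... | x , y , σx≡σy , τx≢τy = Subset.p⊂q⇒∣p∣<∣q∣ (leadersσ⊆leadersτ , witness)
    where
    σ∘τ : ∀ z → σ (τ z) ≡ σ z
    σ∘τ z = τ≼σ _ _ (proj₂ (cτ z))
    leadersσ⊆leadersτ : leaders σ ⊆ leaders τ
    leadersσ⊆leadersτ {j} j∈ = Equivalence.from (∈-leaders τ) (Fin.≤-antisym (proj₁ (cτ j))
      (≡.subst (Fin._≤ τ j) (≡.trans (σ∘τ j) (Equivalence.to (∈-leaders σ) j∈)) (proj₁ (cσ (τ j)))))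
    τ-leader : ∀ z → τ z Subset.∈ leaders τ
    τ-leader z = Equivalence.from (∈-leaders τ) (proj₂ (cτ z))
    witness : ∃ λ j → j Subset.∈ leaders τ × j Subset.∉ leaders σ
    witness with σ (τ x) Fin.≟ τ x | σ (τ y) Fin.≟ τ y
    ... | no  nx | _      = τ x , τ-leader x , nx ∘ Equivalence.to (∈-leaders σ)
    ... | yes _  | no ny  = τ y , τ-leader y , ny ∘ Equivalence.to (∈-leaders σ)
    ... | yes fx | yes fy = ⊥-elim (τx≢τy (≡.trans (≡.sym fx) (≡.trans (σ∘τ x) (≡.trans σx≡σy (≡.trans (≡.sym (σ∘τ y)) fy)))))

module PartitionSums {c ℓ} (R : Ring c ℓ) where
  open Ring R hiding (zero)
  open RingSum R
  open Labellings
  open import Relation.Binary.Reasoning.Setoid setoid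

  ∑-allFin-unique : ∀ {k} (d : Fin k) (G : Fin k → Carrier) → ∑[ c ∈ allFin k ] when (c Fin.≟ d) (G c) ≈ G d
  ∑-allFin-unique {suc k} zero G = begin
    ∑[ c ∈ allFin (suc k) ] when (c Fin.≟ zero) (G c)  ≈⟨ ∑-allFin-suc (λ c → when (c Fin.≟ zero) (G c)) ⟩
    G zero + ∑[ c ∈ allFin k ] when (suc c Fin.≟ zero) (G (suc c))
      ≈⟨ +-cong refl (∑-≈ε (allFin k) (λ c → when-no (suc c Fin.≟ zero) (G (suc c)) λ ())) ⟩
    G zero + 0#  ≈⟨ +-identityʳ _ ⟩
    G zero ∎
  ∑-allFin-unique {suc k} (suc d) G = begin
    ∑[ c ∈ allFin (suc k) ] when (c Fin.≟ suc d) (G c)  ≈⟨ ∑-allFin-suc (λ c → when (c Fin.≟ suc d) (G c)) ⟩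
    when (zero Fin.≟ suc d) (G zero) + ∑[ c ∈ allFin k ] when (suc c Fin.≟ suc d) (G (suc c))
      ≈⟨ +-cong (when-no (zero Fin.≟ suc d) (G zero) λ ())
                (∑-cong (allFin k) (λ c → when-⇔ (suc c Fin.≟ suc d) (c Fin.≟ d) _ (mk⇔ Fin.suc-injective (≡.cong suc)))) ⟩
    0# + ∑[ c ∈ allFin k ] when (c Fin.≟ d) (G (suc c))  ≈⟨ +-identityˡ _ ⟩
    ∑[ c ∈ allFin k ] when (c Fin.≟ d) (G (suc c))  ≈⟨ ∑-allFin-unique d (G ∘ suc) ⟩
    G (suc d) ∎

  ∑-allFuns-unique : ∀ {n k} (g : Labelling n k) (F : Labelling n k → Carrier) → F Preserves _≗_ ⟶ _≈_ →
    ∑[ f ∈ allFuns n k ] when (f ≗? g) (F f) ≈ F g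
  ∑-allFuns-unique {zero} g F F-resp = trans (+-identityʳ _) (trans (when-yes ((λ ()) ≗? g) _ (λ ())) (F-resp (λ ())))
  ∑-allFuns-unique {suc n} {k} g F F-resp = begin
    ∑[ f ∈ allFuns (suc n) k ] when (f ≗? g) (F f)
      ≈⟨ ∑-allFuns-suc (λ f → when (f ≗? g) (F f)) ⟩
    ∑[ f ∈ allFuns n k ] ∑[ c ∈ allFin k ] when (cons c f ≗? g) (F (cons c f))
      ≈⟨ ∑-cong (allFuns n k) (λ f → ∑-cong (allFin k) (λ c → trans
           (when-⇔ (cons c f ≗? g) ((f ≗? g ∘ suc) ×-dec (c Fin.≟ g zero)) _ (cons-≗⇔ c f g))
           (when-× (f ≗? g ∘ suc) (c Fin.≟ g zero) _))) ⟩
    ∑[ f ∈ allFuns n k ] ∑[ c ∈ allFin k ] when (f ≗? g ∘ suc) (when (c Fin.≟ g zero) (F (cons c f)))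
      ≈⟨ ∑-cong (allFuns n k) (λ f → trans (∑-when (f ≗? g ∘ suc) (allFin k) _)
           (when-cong (f ≗? g ∘ suc) (λ _ → ∑-allFin-unique (g zero) (λ c → F (cons c f))))) ⟩
    ∑[ f ∈ allFuns n k ] when (f ≗? g ∘ suc) (F (cons (g zero) f))
      ≈⟨ ∑-allFuns-unique (g ∘ suc) (F ∘ cons (g zero)) (λ e → F-resp λ { zero → ≡.refl ; (suc i) → e i }) ⟩
    F (cons (g zero) (g ∘ suc))
      ≈⟨ F-resp (λ { zero → ≡.refl ; (suc i) → ≡.refl }) ⟩
    F g ∎

  ∑-allFuns-constant : ∀ {d k} (F : Labelling (suc d) k → Carrier) → F Preserves _≗_ ⟶ _≈_ →
    ∑[ f ∈ allFuns (suc d) k ] when (constant? f) (F f) ≈ ∑[ c ∈ allFin k ] F (λ _ → c)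
  ∑-allFuns-constant {d} {k} F F-resp = begin
    ∑[ f ∈ allFuns (suc d) k ] when (constant? f) (F f)
      ≈⟨ ∑-cong (allFuns (suc d) k) (λ f → split f (constant? f)) ⟩
    ∑[ f ∈ allFuns (suc d) k ] ∑[ c ∈ allFin k ] when (f ≗? (λ _ → c)) (F f)
      ≈⟨ ∑-comm (allFuns (suc d) k) (allFin k) _ ⟩
    ∑[ c ∈ allFin k ] ∑[ f ∈ allFuns (suc d) k ] when (f ≗? (λ _ → c)) (F f)
      ≈⟨ ∑-cong (allFin k) (λ c → ∑-allFuns-unique (λ _ → c) F F-resp) ⟩
    ∑[ c ∈ allFin k ] F (λ _ → c) ∎
    where
    split : ∀ f (d : Dec (Constant f)) → when d (F f) ≈ ∑[ c ∈ allFin k ] when (f ≗? (λ _ → c)) (F f)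
    split f (yes const) = sym (trans
      (∑-cong (allFin k) λ c → when-⇔ (f ≗? (λ _ → c)) (c Fin.≟ f zero) _
        (mk⇔ (λ e → ≡.sym (e zero)) (λ e i → ≡.trans (const i zero) (≡.sym e))))
      (∑-allFin-unique (f zero) (λ _ → F f)))
    split f (no ¬const) = sym (∑-≈ε (allFin k) λ c →
      when-no (f ≗? (λ _ → c)) _ (λ e → ¬const λ i j → ≡.trans (e i) (≡.sym (e j))))

  -- every kernel class contains exactly one canonical labelling, namely canon κ
  ∑-Π-kernel : ∀ {n a} (κ : Labelling n a) (F : Labelling n n → Carrier) → F Preserves _≗_ ⟶ _≈_ →
    ∑[ τ ∈ Π n ] when (τ ∼? κ) (F τ) ≈ F (canon κ)
  ∑-Π-kernel {n} κ F F-resp = begin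
    ∑[ τ ∈ Π n ] when (τ ∼? κ) (F τ)
      ≈⟨ ∑-filter Canonical? (allFuns n n) _ ⟩
    ∑[ τ ∈ allFuns n n ] when (Canonical? τ) (when (τ ∼? κ) (F τ))
      ≈⟨ ∑-cong (allFuns n n) (λ τ → trans (sym (when-× (Canonical? τ) (τ ∼? κ) _))
           (when-⇔ (Canonical? τ ×-dec τ ∼? κ) (τ ≗? canon κ) _ (⇔.sym (≗canon⇔canonical∼ κ)))) ⟩
    ∑[ τ ∈ allFuns n n ] when (τ ≗? canon κ) (F τ)
      ≈⟨ ∑-allFuns-unique (canon κ) F F-resp ⟩
    F (canon κ) ∎

module Möbius (K : CommutativeRing 0ℓ 0ℓ) where
  open Over K using (μFuel; μ)
  open CommutativeRing K hiding (zero)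
  open RingSum ring
  open PartitionSums ring
  open Labellings
  open Blocks
  open import Relation.Binary.Reasoning.Setoid setoid
  open import Algebra.Properties.Ring ring using (-‿involutive)

  μFuel-≽ : ∀ {n} f (τ σ : Labelling n n) → σ ≼ τ → μFuel f τ σ ≈ 1#
  μFuel-≽ f τ σ σ≼τ rewrite dec-true (σ ≼? τ) σ≼τ = refl

  μFuel-zero : ∀ {n} (τ σ : Labelling n n) → ¬ (σ ≼ τ) → μFuel 0 τ σ ≈ 0#
  μFuel-zero τ σ σ⋠τ rewrite dec-false (σ ≼? τ) σ⋠τ = refl

  μFuel-suc : ∀ {n} f (τ σ : Labelling n n) → ¬ (σ ≼ τ) →
    μFuel (suc f) τ σ ≈ - ∑[ ρ ∈ Π n ] when (τ ≼? ρ) (when (ρ ≼? σ) (when (¬? (σ ≼? ρ)) (μFuel f τ ρ)))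
  μFuel-suc {n} f τ σ σ⋠τ rewrite dec-false (σ ≼? τ) σ⋠τ =
    -‿cong (trans (∑-filter (λ ρ → (τ ≼? ρ) ×-dec (ρ ≼? σ) ×-dec ¬? (σ ≼? ρ)) (Π n) (μFuel f τ)) (∑-cong (Π n) λ ρ →
      trans (when-× (τ ≼? ρ) ((ρ ≼? σ) ×-dec ¬? (σ ≼? ρ)) _) (when-cong (τ ≼? ρ) λ _ → when-× (ρ ≼? σ) (¬? (σ ≼? ρ)) _)))

  μFuel-resp-≗ : ∀ {n} f (τ : Labelling n n) → μFuel f τ Preserves _≗_ ⟶ _≈_
  μFuel-resp-≗ f τ {σ} {σ′} σ≗σ′ with σ ≼? τ
  ... | yes σ≼τ = trans (μFuel-≽ f τ σ σ≼τ) (sym (μFuel-≽ f τ σ′ (Equivalence.to (≼-respˡ-∼ (≗⇒∼ σ≗σ′)) σ≼τ)))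
  ... | no σ⋠τ = go f
    where
    σ′⋠τ : ¬ (σ′ ≼ τ)
    σ′⋠τ = Equivalence.to (¬-cong-⇔ (≼-respˡ-∼ (≗⇒∼ σ≗σ′))) σ⋠τ
    go : ∀ f → μFuel f τ σ ≈ μFuel f τ σ′
    go zero    = trans (μFuel-zero τ σ σ⋠τ) (sym (μFuel-zero τ σ′ σ′⋠τ))
    go (suc f) = trans (μFuel-suc f τ σ σ⋠τ) (trans (-‿cong (∑-cong (Π _) λ ρ → when-cong (τ ≼? ρ) λ _ →
        trans (when-⇔ (ρ ≼? σ) (ρ ≼? σ′) _ (≼-respʳ-∼ (≗⇒∼ σ≗σ′)))
              (when-cong (ρ ≼? σ′) λ _ → when-⇔ (¬? (σ ≼? ρ)) (¬? (σ′ ≼? ρ)) _ (¬-cong-⇔ (≼-respˡ-∼ (≗⇒∼ σ≗σ′))))))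
      (sym (μFuel-suc f τ σ′ σ′⋠τ)))

  -- a chain from τ up to σ has length at most blockCount τ - blockCount σ, so this fuel suffices
  μFuel-stable : ∀ {n} f {τ σ : Labelling n n} → Canonical τ → Canonical σ → τ ≼ σ →
    blockCount τ ≤ f ℕ.+ blockCount σ → μFuel f τ σ ≈ μFuel (suc f) τ σ
  μFuel-stable f {τ} {σ} cτ cσ τ≼σ bound with σ ≼? τ
  μFuel-stable f       {τ} {σ} cτ cσ τ≼σ bound | yes σ≼τ =
    trans (μFuel-≽ f τ σ σ≼τ) (sym (μFuel-≽ (suc f) τ σ σ≼τ))
  μFuel-stable zero    {τ} {σ} cτ cσ τ≼σ bound | no σ⋠τ =
    ⊥-elim (ℕ.<⇒≱ (blockCount-< cτ cσ τ≼σ σ⋠τ) bound)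
  μFuel-stable (suc f) {τ} {σ} cτ cσ τ≼σ bound | no σ⋠τ =
    trans (μFuel-suc f τ σ σ⋠τ) (trans (-‿cong (∑-cong-∈ (Π _) λ {ρ} ρ∈ →
      when-cong (τ ≼? ρ) λ τ≼ρ → when-cong (ρ ≼? σ) λ ρ≼σ → when-cong (¬? (σ ≼? ρ)) λ σ⋠ρ →
        let cρ = ∈Π⇒canonical ρ∈ in
        μFuel-stable f cτ cρ τ≼ρ (ℕ.≤-trans bound (ℕ.≤-trans (ℕ.≤-reflexive (≡.sym (ℕ.+-suc f _)))
          (ℕ.+-monoʳ-≤ f (blockCount-< cρ cσ ρ≼σ σ⋠ρ))))))
      (sym (μFuel-suc (suc f) τ σ σ⋠τ)))

  μ-recursion : ∀ {n} {τ σ : Labelling n n} → Canonical τ → ¬ (σ ≼ τ) →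
    μ τ σ ≈ - ∑[ ρ ∈ Π n ] when (τ ≼? ρ) (when (ρ ≼? σ) (when (¬? (σ ≼? ρ)) (μ τ ρ)))
  μ-recursion {zero}          cτ σ⋠τ = ⊥-elim (σ⋠τ λ ())
  μ-recursion {suc n} {τ} {σ} cτ σ⋠τ = trans (μFuel-suc n τ σ σ⋠τ) (-‿cong (∑-cong-∈ (Π (suc n)) λ {ρ} ρ∈ →
    when-cong (τ ≼? ρ) λ τ≼ρ → when-cong (ρ ≼? σ) λ _ → when-cong (¬? (σ ≼? ρ)) λ _ →
      let cρ = ∈Π⇒canonical ρ∈ in
      μFuel-stable n cτ cρ τ≼ρ (ℕ.≤-trans (blockCount-≤ τ)
        (≡.subst (_≤ n ℕ.+ blockCount ρ) (ℕ.+-comm n 1) (ℕ.+-monoʳ-≤ n (blockCount-pos cρ))))))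

  ∑-μ-interval : ∀ {n} {τ ρ : Labelling n n} → Canonical τ → Canonical ρ →
    ∑[ σ ∈ Π n ] when (τ ≼? σ) (when (σ ≼? ρ) (μ τ σ)) ≈ when (ρ ∼? τ) 1#
  ∑-μ-interval {n} {τ} {ρ} cτ cρ with τ ≼? ρ | ρ ≼? τ
  ... | no τ⋠ρ | _ = trans
    (∑-≈ε (Π n) λ σ → trans (when²-⇔ (τ ≼? σ) (σ ≼? ρ) (τ ≼? ρ) _ (mk⇔ (λ (p , q) → ≼-trans p q) (⊥-elim ∘ τ⋠ρ)))
                             (when-no (τ ≼? ρ) _ τ⋠ρ))
    (sym (when-no (ρ ∼? τ) 1# (τ⋠ρ ∘ proj₂)))
  ... | yes τ≼ρ | yes ρ≼τ = begin
    ∑[ σ ∈ Π n ] when (τ ≼? σ) (when (σ ≼? ρ) (μ τ σ))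
      ≈⟨ ∑-cong (Π n) (λ σ → trans (when-cong (τ ≼? σ) λ _ → when-cong (σ ≼? ρ) λ σ≼ρ → μFuel-≽ n τ σ (≼-trans σ≼ρ ρ≼τ))
           (when²-⇔ (τ ≼? σ) (σ ≼? ρ) (σ ∼? τ) 1# (mk⇔ (λ (p , q) → ≼-trans q ρ≼τ , p) (λ (p , q) → q , ≼-trans p τ≼ρ)))) ⟩
    ∑[ σ ∈ Π n ] when (σ ∼? τ) 1#  ≈⟨ ∑-Π-kernel τ (λ _ → 1#) (λ _ → refl) ⟩
    1#                             ≈⟨ sym (when-yes (ρ ∼? τ) 1# (ρ≼τ , τ≼ρ)) ⟩
    when (ρ ∼? τ) 1# ∎
  ... | yes τ≼ρ | no ρ⋠τ = begin
    ∑[ σ ∈ Π n ] when (τ ≼? σ) (when (σ ≼? ρ) (μ τ σ))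
      ≈⟨ ∑-cong (Π n) (λ σ → trans (when-cong (τ ≼? σ) λ _ → trans (when-cong (σ ≼? ρ) λ _ → when-split (ρ ≼? σ) (μ τ σ))
           (when-+ (σ ≼? ρ) _ _)) (when-+ (τ ≼? σ) _ _)) ⟩
    ∑[ σ ∈ Π n ] (when (τ ≼? σ) (when (σ ≼? ρ) (when (ρ ≼? σ) (μ τ σ))) + Below σ)
      ≈⟨ ∑-∙ (Π n) _ Below ⟩
    ∑[ σ ∈ Π n ] when (τ ≼? σ) (when (σ ≼? ρ) (when (ρ ≼? σ) (μ τ σ))) + ∑ (Π n) Below
      ≈⟨ +-cong (∑-cong (Π n) λ σ → trans (when-cong (τ ≼? σ) λ _ → sym (when-× (σ ≼? ρ) (ρ ≼? σ) _))
           (when²-⇔ (τ ≼? σ) (σ ∼? ρ) (σ ∼? ρ) _ (mk⇔ proj₂ λ σ∼ρ → ≼-trans τ≼ρ (proj₂ σ∼ρ) , σ∼ρ)))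
           (trans (sym (-‿involutive _)) (-‿cong (sym (μ-recursion cτ ρ⋠τ)))) ⟩
    ∑[ σ ∈ Π n ] when (σ ∼? ρ) (μ τ σ) + - μ τ ρ
      ≈⟨ +-cong (trans (∑-Π-kernel ρ (μ τ) (μFuel-resp-≗ n τ)) (μFuel-resp-≗ n τ (≡.sym ∘ canonical⇒≗canon cρ))) refl ⟩
    μ τ ρ + - μ τ ρ  ≈⟨ -‿inverseʳ _ ⟩
    0#               ≈⟨ sym (when-no (ρ ∼? τ) 1# (ρ⋠τ ∘ proj₁)) ⟩
    when (ρ ∼? τ) 1# ∎
    where
    Below : Labelling n n → Carrier
    Below σ = when (τ ≼? σ) (when (σ ≼? ρ) (when (¬? (ρ ≼? σ)) (μ τ σ)))

  möbius-inversion : ∀ {n} (f g : Labelling n n → Carrier) → g Preserves _≗_ ⟶ _≈_ →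
    ∑[ σ ∈ Π n ] (∑ (filter (σ ≼?_) (Π n)) g * ∑[ τ ∈ filter (_≼? σ) (Π n) ] (f τ * μ τ σ))
      ≈ ∑[ τ ∈ Π n ] (f τ * g τ)
  möbius-inversion {n} f g g-resp = begin
    ∑[ σ ∈ Π n ] (∑ (filter (σ ≼?_) (Π n)) g * ∑[ τ ∈ filter (_≼? σ) (Π n) ] (f τ * μ τ σ))
      ≈⟨ ∑-cong (Π n) (λ σ → *-cong (∑-filter (σ ≼?_) (Π n) g) (∑-filter (_≼? σ) (Π n) _)) ⟩
    ∑[ σ ∈ Π n ] (∑[ ρ ∈ Π n ] when (σ ≼? ρ) (g ρ) * ∑[ τ ∈ Π n ] when (τ ≼? σ) (f τ * μ τ σ))
      ≈⟨ ∑-cong (Π n) (λ σ → trans (∑-distribʳ (Π n) _ _) (∑-cong (Π n) λ ρ →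
           trans (∑-distribˡ (Π n) _ _) (∑-cong (Π n) λ τ → rearrange σ ρ τ))) ⟩
    ∑[ σ ∈ Π n ] ∑[ ρ ∈ Π n ] ∑[ τ ∈ Π n ] Term σ ρ τ
      ≈⟨ ∑-cong (Π n) (λ σ → ∑-comm (Π n) (Π n) (Term σ)) ⟩
    ∑[ σ ∈ Π n ] ∑[ τ ∈ Π n ] ∑[ ρ ∈ Π n ] Term σ ρ τ
      ≈⟨ ∑-comm (Π n) (Π n) _ ⟩
    ∑[ τ ∈ Π n ] ∑[ σ ∈ Π n ] ∑[ ρ ∈ Π n ] Term σ ρ τ
      ≈⟨ ∑-cong (Π n) (λ τ → ∑-comm (Π n) (Π n) (λ σ ρ → Term σ ρ τ)) ⟩
    ∑[ τ ∈ Π n ] ∑[ ρ ∈ Π n ] ∑[ σ ∈ Π n ] Term σ ρ τ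
      ≈⟨ ∑-cong-∈ (Π n) (λ τ∈ → ∑-cong-∈ (Π n) λ ρ∈ → trans (sym (∑-distribˡ (Π n) _ _))
           (*-cong refl (∑-μ-interval (∈Π⇒canonical τ∈) (∈Π⇒canonical ρ∈)))) ⟩
    ∑[ τ ∈ Π n ] ∑[ ρ ∈ Π n ] (f τ * g ρ * when (ρ ∼? τ) 1#)
      ≈⟨ ∑-cong (Π n) (λ τ → ∑-cong (Π n) λ ρ →
           trans (when-*ˡ (ρ ∼? τ) _ 1#) (when-cong (ρ ∼? τ) λ _ → *-identityʳ _)) ⟩
    ∑[ τ ∈ Π n ] ∑[ ρ ∈ Π n ] when (ρ ∼? τ) (f τ * g ρ)
      ≈⟨ ∑-cong-∈ (Π n) (λ {τ} τ∈ → trans (∑-Π-kernel τ (λ ρ → f τ * g ρ) (*-cong refl ∘ g-resp))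
           (*-cong refl (g-resp (≡.sym ∘ canonical⇒≗canon (∈Π⇒canonical τ∈))))) ⟩
    ∑[ τ ∈ Π n ] (f τ * g τ) ∎
    where
    Term : Labelling n n → Labelling n n → Labelling n n → Carrier
    Term σ ρ τ = f τ * g ρ * when (τ ≼? σ) (when (σ ≼? ρ) (μ τ σ))
    rearrange : ∀ σ ρ τ → when (σ ≼? ρ) (g ρ) * when (τ ≼? σ) (f τ * μ τ σ) ≈ Term σ ρ τ
    rearrange σ ρ τ = begin
      when (σ ≼? ρ) (g ρ) * when (τ ≼? σ) (f τ * μ τ σ)
        ≈⟨ when-*-when (σ ≼? ρ) (τ ≼? σ) _ _ ⟩
      when (τ ≼? σ) (when (σ ≼? ρ) (g ρ * (f τ * μ τ σ)))
        ≈⟨ when-cong (τ ≼? σ) (λ _ → when-cong (σ ≼? ρ) λ _ → trans (sym (*-assoc _ _ _)) (*-cong (*-comm _ _) refl)) ⟩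
      when (τ ≼? σ) (when (σ ≼? ρ) (f τ * g ρ * μ τ σ))
        ≈⟨ sym (trans (when-*ˡ (τ ≼? σ) _ _) (when-cong (τ ≼? σ) λ _ → when-*ˡ (σ ≼? ρ) _ _)) ⟩
      Term σ ρ τ ∎

module RootsOfUnity (K : CommutativeRing 0ℓ 0ℓ) where
  open Over K using (powK; natK; IsFieldChar0)
  open CommutativeRing K hiding (zero)
  open RingSum ring
  private module Product = ListSum *-commutativeMonoid
  open Subsets
  open import Relation.Binary.Reasoning.Setoid setoid
  open import Algebra.Properties.Semiring.Exp semiring using (_^_; ^-assocʳ; ^-congˡ)
  open import Algebra.Properties.Monoid.Mult *-monoid using (×-idem)
  open import Algebra.Properties.CommutativeSemigroup *-commutativeSemigroup using (interchange; x∙yz≈y∙xz)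
  open import Algebra.Properties.Ring ring using (-1*x≈-x)

  ∏ : {X : Set} → List X → (X → Carrier) → Carrier
  ∏ = Product.∑

  powK≡^ : ∀ x n → powK x n ≡ x ^ n
  powK≡^ x zero    = ≡.refl
  powK≡^ x (suc n) = ≡.cong (x *_) (powK≡^ x n)

  ∏-const : ∀ d (x : Carrier) → ∏ (allFin d) (λ _ → x) ≈ x ^ d
  ∏-const zero    x = refl
  ∏-const (suc d) x = trans (Product.∑-allFin-suc {d} (λ _ → x)) (*-cong refl (∏-const d x))

  ∑-1≈natK : ∀ k → ∑[ _ ∈ allFin k ] 1# ≈ natK k
  ∑-1≈natK zero    = refl
  ∑-1≈natK (suc k) = trans (∑-allFin-suc {k} (λ _ → 1#)) (+-cong refl (∑-1≈natK k))

  *-fixed⇒≈0 : IsFieldChar0 → ∀ {a y} → ¬ (a ≈ 1#) → a * y ≈ y → y ≈ 0#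
  *-fixed⇒≈0 (_ , inverse , _) {a} {y} a≉1 ay≈y with inverse (a - 1#) (a≉1 ∘ a-1≈0⇒a≈1)
    where
    a-1≈0⇒a≈1 : a - 1# ≈ 0# → a ≈ 1#
    a-1≈0⇒a≈1 a-1≈0 = begin
      a                ≈⟨ +-identityʳ a ⟨
      a + 0#           ≈⟨ +-cong refl (-‿inverseˡ 1#) ⟨
      a + (- 1# + 1#)  ≈⟨ +-assoc _ _ _ ⟨
      (a - 1#) + 1#    ≈⟨ +-cong a-1≈0 refl ⟩
      0# + 1#          ≈⟨ +-identityˡ _ ⟩
      1#               ∎
  ... | b , [a-1]b≈1 = begin
    y                    ≈⟨ *-identityˡ y ⟨
    1# * y               ≈⟨ *-cong (trans (sym [a-1]b≈1) (*-comm _ _)) refl ⟩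
    b * (a - 1#) * y     ≈⟨ *-assoc _ _ _ ⟩
    b * ((a - 1#) * y)   ≈⟨ *-cong refl (distribʳ _ _ _) ⟩
    b * (a * y + - 1# * y) ≈⟨ *-cong refl (+-cong ay≈y (-1*x≈-x y)) ⟩
    b * (y - y)          ≈⟨ *-cong refl (-‿inverseʳ y) ⟩
    b * 0#               ≈⟨ zeroʳ b ⟩
    0#                   ∎

  module Weights {m′ : ℕ} (ω : Carrier) (ω^M≈1 : powK ω (suc m′) ≈ 1#) where

    -- ω^(c+1), the coefficient of the (c+1)-st copy in Y^ω
    coeff : Fin (suc m′) → Carrier
    coeff c = powK ω (suc (toℕ c))

    weight : ∀ {d} → Labelling d (suc m′) → Carrier
    weight {d} k = ∏ (allFin d) (coeff ∘ k)

    weight-resp-≗ : ∀ {d} → weight {d} Preserves _≗_ ⟶ _≈_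
    weight-resp-≗ {d} k≗k′ = Product.∑-cong (allFin d) λ j → reflexive (≡.cong coeff (k≗k′ j))

    weight-suc : ∀ {d} (k : Labelling (suc d) (suc m′)) → weight k ≈ coeff (k zero) * weight (k ∘ suc)
    weight-suc k = Product.∑-allFin-suc (coeff ∘ k)

    ω*coeff∘cyclicPred : ∀ c → ω * coeff (cyclicPred c) ≈ coeff c
    ω*coeff∘cyclicPred zero = begin
      ω * powK ω (suc (toℕ (fromℕ m′)))  ≡⟨ ≡.cong (λ e → ω * powK ω (suc e)) (Fin.toℕ-fromℕ m′) ⟩
      ω * powK ω (suc m′)                ≈⟨ *-cong refl ω^M≈1 ⟩
      ω * 1#                             ∎
    ω*coeff∘cyclicPred (suc i) = reflexive (≡.cong (λ e → ω * powK ω (suc e)) (Fin.toℕ-inject₁ i))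

    weight-constant : ∀ c → weight (λ (_ : Fin (suc m′)) → c) ≈ 1#
    weight-constant c = begin
      ∏ (allFin M) (λ _ → coeff c)  ≈⟨ ∏-const M (coeff c) ⟩
      coeff c ^ M                   ≡⟨ ≡.cong (_^ M) (powK≡^ ω (suc (toℕ c))) ⟩
      (ω ^ suc (toℕ c)) ^ M         ≈⟨ ^-assocʳ ω (suc (toℕ c)) M ⟩
      ω ^ (suc (toℕ c) ℕ.* M)       ≡⟨ ≡.cong (ω ^_) (ℕ.*-comm (suc (toℕ c)) M) ⟩
      ω ^ (M ℕ.* suc (toℕ c))       ≈⟨ ^-assocʳ ω M (suc (toℕ c)) ⟨
      (ω ^ M) ^ suc (toℕ c)         ≈⟨ ^-congˡ (suc (toℕ c)) (trans (reflexive (≡.sym (powK≡^ ω M))) ω^M≈1) ⟩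
      1# ^ suc (toℕ c)              ≈⟨ ×-idem (*-identityˡ 1#) (suc (toℕ c)) ⟩
      1#                            ∎
      where
      M : ℕ
      M = suc m′

    shiftOn : ∀ {d} → Subset d → Fin d → Fin (suc m′) → Fin (suc m′)
    shiftOn S j = if Vec.lookup S j then cyclicPred else id

    weight-shiftOn : ∀ {d} (S : Subset d) (k : Labelling d (suc m′)) →
      weight k ≈ powK ω ∣ S ∣ * weight (λ j → shiftOn S j (k j))
    weight-shiftOn         []          k = sym (*-identityˡ 1#)
    weight-shiftOn {suc d} (true  ∷ S) k = begin
      weight k                                                   ≈⟨ weight-suc k ⟩
      coeff (k zero) * weight (k ∘ suc)                          ≈⟨ *-cong (ω*coeff∘cyclicPred (k zero)) (sym ih) ⟨
      ω * coeff (cyclicPred (k zero)) * (powK ω ∣ S ∣ * weight k′)   ≈⟨ interchange _ _ _ _ ⟩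
      ω * powK ω ∣ S ∣ * (coeff (cyclicPred (k zero)) * weight k′)   ≈⟨ *-cong refl (weight-suc (λ j → shiftOn (true ∷ S) j (k j))) ⟨
      powK ω (suc ∣ S ∣) * weight (λ j → shiftOn (true ∷ S) j (k j)) ∎
      where
      k′ : Labelling d (suc m′)
      k′ j = shiftOn S j (k (suc j))
      ih : weight (k ∘ suc) ≈ powK ω ∣ S ∣ * weight k′
      ih = weight-shiftOn S (k ∘ suc)
    weight-shiftOn {suc d} (false ∷ S) k = begin
      weight k                                        ≈⟨ weight-suc k ⟩
      coeff (k zero) * weight (k ∘ suc)               ≈⟨ *-cong refl (weight-shiftOn S (k ∘ suc)) ⟩
      coeff (k zero) * (powK ω ∣ S ∣ * weight k′)     ≈⟨ x∙yz≈y∙xz _ _ _ ⟩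
      powK ω ∣ S ∣ * (coeff (k zero) * weight k′)     ≈⟨ *-cong refl (weight-suc (λ j → shiftOn (false ∷ S) j (k j))) ⟨
      powK ω ∣ S ∣ * weight (λ j → shiftOn (false ∷ S) j (k j)) ∎
      where
      k′ : Labelling d (suc m′)
      k′ j = shiftOn S j (k (suc j))

    shiftOn-injective : ∀ {d} (S : Subset d) j {c c′} → shiftOn S j c ≡ shiftOn S j c′ → c ≡ c′
    shiftOn-injective S j with Vec.lookup S j
    ... | true  = cyclicPred-injective
    ... | false = id

    ∑-shiftOn : ∀ {d} (S : Subset d) j (G : Fin (suc m′) → Carrier) →
      ∑ (allFin (suc m′)) (G ∘ shiftOn S j) ≈ ∑ (allFin (suc m′)) G
    ∑-shiftOn S j G with Vec.lookup S j
    ... | true  = ∑-cyclicPred G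
    ... | false = refl

  -- ρ plays the role of the interval partition 0̃_m, and rep picks a position in each row
  module Indecomposability (fc : IsFieldChar0) {m′ : ℕ} (ω : Carrier) (ω-prim : Over.PrimitiveRoot K (suc m′) ω)
                           {n} (ρ : Labelling n (suc m′)) (rep : Fin (suc m′) → Fin n) (ρ∘rep : ∀ i → ρ (rep i) ≡ i) where
    open Weights {m′} ω (proj₁ ω-prim)
    open Labellings
    open PartitionSums ring

    M : ℕ
    M = suc m′

    weightIf : Labelling n n → Labelling M M → Carrier
    weightIf σ k = when (σ ≼? (k ∘ ρ)) (weight k)

    weightIf-resp-≗ : ∀ σ → weightIf σ Preserves _≗_ ⟶ _≈_
    weightIf-resp-≗ σ {k} {k′} k≗k′ = trans (when-⇔ (σ ≼? (k ∘ ρ)) (σ ≼? (k′ ∘ ρ)) _ (≼-respʳ-∼ (≗⇒∼ (k≗k′ ∘ ρ))))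
      (when-cong (σ ≼? (k′ ∘ ρ)) λ _ → weight-resp-≗ k≗k′)

    JoinIsOne⇒≼∘ρ⇔Constant : ∀ {σ} → JoinIsOne σ ρ → (k : Labelling M M) → σ ≼ (k ∘ ρ) ⇔ Constant k
    JoinIsOne⇒≼∘ρ⇔Constant {σ} join k = mk⇔ to (λ const x y _ → const (ρ x) (ρ y))
      where
      to : σ ≼ (k ∘ ρ) → Constant k
      to σ≼kρ i j with canon∈Π (k ∘ ρ)
      ... | τ , τ∈ , τ≗ = ≡.trans (≡.cong k (≡.sym (ρ∘rep i))) (≡.trans (τ≼kρ (rep i) (rep j) (one _ _)) (≡.cong k (ρ∘rep j)))
        where
        τ∼kρ : τ ∼ (k ∘ ρ)
        τ∼kρ = ∼-trans (≗⇒∼ τ≗) (canon∼ (k ∘ ρ))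
        τ≼kρ : τ ≼ (k ∘ ρ)
        τ≼kρ = proj₁ τ∼kρ
        kρ≼τ : (k ∘ ρ) ≼ τ
        kρ≼τ = proj₂ τ∼kρ
        one : IsOne τ
        one = All.lookup join τ∈ (≼-trans σ≼kρ kρ≼τ) (≼-trans (λ x y → ≡.cong k) kρ≼τ)

    ∑-weightIf-indecomposable : ∀ {σ} → JoinIsOne σ ρ → ∑ (allFuns M M) (weightIf σ) ≈ natK M
    ∑-weightIf-indecomposable {σ} join = begin
      ∑ (allFuns M M) (weightIf σ)
        ≈⟨ ∑-cong (allFuns M M) (λ k → when-⇔ (σ ≼? (k ∘ ρ)) (constant? k) _ (JoinIsOne⇒≼∘ρ⇔Constant join k)) ⟩
      ∑[ k ∈ allFuns M M ] when (constant? k) (weight k)  ≈⟨ ∑-allFuns-constant {m′} weight weight-resp-≗ ⟩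
      ∑[ c ∈ allFin M ] weight (λ (_ : Fin M) → c)        ≈⟨ ∑-cong (allFin M) weight-constant ⟩
      ∑[ c ∈ allFin M ] 1#                                 ≈⟨ ∑-1≈natK M ⟩
      natK M                                               ∎

    module BlockRotation {σ π : Labelling n n} (σ≼π : σ ≼ π) (ρ≼π : ρ ≼ π) (x : Fin n) where
      inBlock? : ∀ i → Dec (π (rep i) ≡ π x)
      inBlock? i = π (rep i) Fin.≟ π x

      B : Subset M
      B = subsetOf inBlock?

      rowBlock : ∀ p → π (rep (ρ p)) ≡ π p
      rowBlock p = ρ≼π _ _ (ρ∘rep (ρ p))

      ∣B∣-pos : 0 < ∣ B ∣
      ∣B∣-pos = ∈⇒∣∣-pos (Equivalence.from (∈-subsetOf inBlock?) (rowBlock x))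

      ∣B∣<M : ∀ {y} → π x ≢ π y → ∣ B ∣ < M
      ∣B∣<M {y} πx≢πy = ∉⇒∣∣<n λ ρy∈B →
        πx≢πy (≡.sym (≡.trans (≡.sym (rowBlock y)) (Equivalence.to (∈-subsetOf inBlock?) ρy∈B)))

      shiftOn-σ-related : ∀ p q → σ p ≡ σ q → shiftOn B (ρ p) ≡ shiftOn B (ρ q)
      shiftOn-σ-related p q σp≡σq = ≡.cong (λ b → if b then cyclicPred else id)
        (≡.trans (Vec.lookup∘tabulate (does ∘ inBlock?) (ρ p))
          (≡.trans (does-⇔ (mk⇔ (≡.trans (≡.sym πpq)) (≡.trans πpq)) (inBlock? (ρ p)) (inBlock? (ρ q)))
            (≡.sym (Vec.lookup∘tabulate (does ∘ inBlock?) (ρ q)))))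
        where
        πpq : π (rep (ρ p)) ≡ π (rep (ρ q))
        πpq = ≡.trans (rowBlock p) (≡.trans (σ≼π p q σp≡σq) (≡.sym (rowBlock q)))

      rotate : Labelling M M → Labelling M M
      rotate k i = shiftOn B i (k i)

      ≼rotate∘ρ⇔≼∘ρ : ∀ k → σ ≼ (rotate k ∘ ρ) ⇔ σ ≼ (k ∘ ρ)
      ≼rotate∘ρ⇔≼∘ρ k = mk⇔
        (λ σ≼ p q σpq → shiftOn-injective B (ρ p) (≡.trans (σ≼ p q σpq) (≡.cong-app (≡.sym (shiftOn-σ-related p q σpq)) _)))
        (λ σ≼ p q σpq → ≡.trans (≡.cong (shiftOn B (ρ p)) (σ≼ p q σpq)) (≡.cong-app (shiftOn-σ-related p q σpq) _))

      ω^∣B∣*∑-weightIf : powK ω ∣ B ∣ * ∑ (allFuns M M) (weightIf σ) ≈ ∑ (allFuns M M) (weightIf σ)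
      ω^∣B∣*∑-weightIf = begin
        powK ω ∣ B ∣ * ∑ (allFuns M M) (weightIf σ)
          ≈⟨ *-cong refl (∑-allFuns-reindex (shiftOn B) (∑-shiftOn B) (weightIf σ) (weightIf-resp-≗ σ)) ⟨
        powK ω ∣ B ∣ * ∑[ k ∈ allFuns M M ] weightIf σ (rotate k)
          ≈⟨ ∑-distribˡ (allFuns M M) _ _ ⟩
        ∑[ k ∈ allFuns M M ] (powK ω ∣ B ∣ * weightIf σ (rotate k))
          ≈⟨ ∑-cong (allFuns M M) (λ k → trans (when-*ˡ (σ ≼? (rotate k ∘ ρ)) _ _)
               (trans (when-⇔ (σ ≼? (rotate k ∘ ρ)) (σ ≼? (k ∘ ρ)) _ (≼rotate∘ρ⇔≼∘ρ k))
                 (when-cong (σ ≼? (k ∘ ρ)) λ _ → sym (weight-shiftOn B k)))) ⟩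
        ∑ (allFuns M M) (weightIf σ) ∎

    ∑-weightIf-decomposable : ∀ {σ π : Labelling n n} → σ ≼ π → ρ ≼ π → ∀ {x y} → π x ≢ π y →
      ∑ (allFuns M M) (weightIf σ) ≈ 0#
    ∑-weightIf-decomposable σ≼π ρ≼π {x} πx≢πy = *-fixed⇒≈0 fc (proj₂ ω-prim _ ∣B∣-pos (∣B∣<M πx≢πy)) ω^∣B∣*∑-weightIf
      where open BlockRotation σ≼π ρ≼π x

    ∑-weightIf : ∀ σ → ∑ (allFuns M M) (weightIf σ) ≈ when (JoinIsOne? σ ρ) (natK M)
    ∑-weightIf σ = byCases (JoinIsOne? σ ρ)
      where
      byCases : (d : Dec (JoinIsOne σ ρ)) → ∑ (allFuns M M) (weightIf σ) ≈ when d (natK M)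
      byCases (yes join) = ∑-weightIf-indecomposable join
      byCases (no ¬join) with ¬JoinIsOne⇒separated σ ρ ¬join
      ... | π , σ≼π , ρ≼π , x , y , πx≢πy = ∑-weightIf-decomposable σ≼π ρ≼π πx≢πy

module Expansion (K : CommutativeRing 0ℓ 0ℓ) where
  open Over K using (UAlg; UFunctional; Embedding)
  module K = CommutativeRing K
  open RootsOfUnity K using (∏)

  module _ (U : UAlg) where
    open UAlg U hiding (zero)
    open RingSum ring using (∑; ∑-cong; ∑-comm; ∑-distribˡ; ∑-distribʳ; ∑-allFuns-suc)
    open import Relation.Binary.Reasoning.Setoid setoid

    ·-*-· : ∀ a b x y → (a · x) * (b · y) ≈ (a K.* b) · (x * y)
    ·-*-· a b x y = begin
      (a · x) * (b · y)    ≈⟨ ·-*ˡ a x _ ⟩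
      a · (x * (b · y))    ≈⟨ ·-cong K.refl (·-*ʳ b x y) ⟩
      a · (b · (x * y))    ≈⟨ ·-assoc a b _ ⟨
      (a K.* b) · (x * y)  ∎

    prod-∑ : ∀ d {M} (a : Fin M → K.Carrier) (Z : Fin d → Fin M → Carrier) →
      prod (tabulate λ j → ∑ (allFin M) (λ c → a c · Z j c))
        ≈ ∑ (allFuns d M) (λ k → ∏ (allFin d) (a ∘ k) · prod (tabulate λ j → Z j (k j)))
    prod-∑ zero    a Z = sym (trans (+-identityʳ _) (·-identity _))
    prod-∑ (suc d) {M} a Z = begin
      ∑ (allFin M) (λ c → a c · Z zero c) * prod (tabulate λ j → ∑ (allFin M) (λ c → a c · Z (suc j) c))
        ≈⟨ *-cong refl (prod-∑ d a (Z ∘ suc)) ⟩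
      ∑ (allFin M) (λ c → a c · Z zero c) * ∑ (allFuns d M) (λ f → ∏ (allFin d) (a ∘ f) · P f)
        ≈⟨ ∑-distribʳ (allFin M) _ _ ⟩
      ∑ (allFin M) (λ c → (a c · Z zero c) * ∑ (allFuns d M) (λ f → ∏ (allFin d) (a ∘ f) · P f))
        ≈⟨ ∑-cong (allFin M) (λ c → trans (∑-distribˡ (allFuns d M) _ _) (∑-cong (allFuns d M) λ f → ·-*-· _ _ _ _)) ⟩
      ∑ (allFin M) (λ c → ∑ (allFuns d M) (λ f → (a c K.* ∏ (allFin d) (a ∘ f)) · (Z zero c * P f)))
        ≈⟨ ∑-comm (allFin M) (allFuns d M) _ ⟩
      ∑ (allFuns d M) (λ f → ∑ (allFin M) (λ c → (a c K.* ∏ (allFin d) (a ∘ f)) · (Z zero c * P f)))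
        ≈⟨ ∑-cong (allFuns d M) (λ f → ∑-cong (allFin M) λ c →
             ·-cong (K.sym (ListSum.∑-allFin-suc K.*-commutativeMonoid (a ∘ cons c f))) refl) ⟩
      ∑ (allFuns d M) (λ f → ∑ (allFin M) (λ c → ∏ (allFin (suc d)) (a ∘ cons c f) · prod (tabulate λ j → Z j (cons c f j))))
        ≈⟨ ∑-allFuns-suc (λ k → ∏ (allFin (suc d)) (a ∘ k) · prod (tabulate λ j → Z j (k j))) ⟨
      ∑ (allFuns (suc d) M) (λ k → ∏ (allFin (suc d)) (a ∘ k) · prod (tabulate λ j → Z j (k j))) ∎
      where
      P : Labelling d M → Carrier
      P f = prod (tabulate λ j → Z (suc j) (f j))

    prod-tabulate-cong : ∀ {d} {F G : Fin d → Carrier} → (∀ j → F j ≈ G j) → prod (tabulate F) ≈ prod (tabulate G)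
    prod-tabulate-cong {zero}  F≈G = refl
    prod-tabulate-cong {suc d} F≈G = *-cong (F≈G zero) (prod-tabulate-cong (F≈G ∘ suc))

    prod-++ : ∀ xs ys → prod (xs List.++ ys) ≈ prod xs * prod ys
    prod-++ []       ys = sym (*-identityˡ _)
    prod-++ (x ∷ xs) ys = trans (*-cong refl (prod-++ xs ys)) (sym (*-assoc _ _ _))

    prod-concat : ∀ xss → prod (List.concat xss) ≈ prod (map prod xss)
    prod-concat []         = refl
    prod-concat (xs ∷ xss) = trans (prod-++ xs (List.concat xss)) (*-cong refl (prod-concat xss))

  module _ {U : UAlg} (φ : UFunctional U) where
    open UAlg U using (_·_) renaming (0# to 0ᵁ; _+_ to _+ᵁ_)
    open UFunctional φ renaming (φ to φ₀)
    open K using (_≈_; _+_; _*_; 0#)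
    open RingSum K.ring using (∑)
    open import Relation.Binary.Reasoning.Setoid K.setoid

    φ-0 : φ₀ 0ᵁ ≈ 0#
    φ-0 = begin
      φ₀ 0ᵁ                        ≈⟨ K.+-identityʳ _ ⟨
      φ₀ 0ᵁ + 0#                   ≈⟨ K.+-cong K.refl (K.-‿inverseʳ _) ⟨
      φ₀ 0ᵁ + (φ₀ 0ᵁ K.- φ₀ 0ᵁ)    ≈⟨ K.+-assoc _ _ _ ⟨
      (φ₀ 0ᵁ + φ₀ 0ᵁ) K.- φ₀ 0ᵁ    ≈⟨ K.+-cong (φ-+ _ _) K.refl ⟨
      φ₀ (0ᵁ +ᵁ 0ᵁ) K.- φ₀ 0ᵁ      ≈⟨ K.+-cong (φ-cong (UAlg.+-identityʳ U _)) K.refl ⟩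
      φ₀ 0ᵁ K.- φ₀ 0ᵁ              ≈⟨ K.-‿inverseʳ _ ⟩
      0#                           ∎

    φ-linear : {X : Set} (L : List X) (w : X → K.Carrier) (Q : X → UAlg.Carrier U) →
      φ₀ (RingSum.∑ (UAlg.ring U) L (λ x → w x · Q x)) ≈ ∑ L (λ x → w x * φ₀ (Q x))
    φ-linear []      w Q = φ-0
    φ-linear (x ∷ L) w Q = K.trans (φ-+ _ _) (K.+-cong (φ-· _ _) (φ-linear L w Q))

  embedding-prod : ∀ {A B : UAlg} (ι : Embedding A B) (xs : List (UAlg.Carrier A)) →
    UAlg._≈_ B (Embedding.f ι (UAlg.prod A xs)) (UAlg.prod B (map (Embedding.f ι) xs))
  embedding-prod         ι []       = Embedding.f-1 ι
  embedding-prod {B = B} ι (x ∷ xs) = UAlg.trans B (Embedding.f-* ι _ _) (UAlg.*-cong B (UAlg.refl B) (embedding-prod ι xs))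

module Transposition where

  transpose : ℕ → ℕ → ℕ → ℕ
  transpose a b x with x ℕ.≟ a | x ℕ.≟ b
  ... | yes _ | _     = b
  ... | no _  | yes _ = a
  ... | no _  | no _  = x

  transpose-a : ∀ a b → transpose a b a ≡ b
  transpose-a a b with a ℕ.≟ a
  ... | yes _  = ≡.refl
  ... | no a≢a = ⊥-elim (a≢a ≡.refl)

  transpose-b : ∀ a b → transpose a b b ≡ a
  transpose-b a b with b ℕ.≟ a | b ℕ.≟ b
  ... | yes b≡a | _      = b≡a
  ... | no _    | yes _  = ≡.refl
  ... | no _    | no b≢b = ⊥-elim (b≢b ≡.refl)

  transpose-other : ∀ a b x → x ≢ a → x ≢ b → transpose a b x ≡ x
  transpose-other a b x x≢a x≢b with x ℕ.≟ a | x ℕ.≟ b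
  ... | yes x≡a | _       = ⊥-elim (x≢a x≡a)
  ... | no _    | yes x≡b = ⊥-elim (x≢b x≡b)
  ... | no _    | no _    = ≡.refl

  transpose-involutive : ∀ a b x → transpose a b (transpose a b x) ≡ x
  transpose-involutive a b x with x ℕ.≟ a | x ℕ.≟ b
  ... | yes ≡.refl | _          = transpose-b x b
  ... | no _       | yes ≡.refl = transpose-a a x
  ... | no x≢a     | no x≢b     = transpose-other a b x x≢a x≢b

  transpose-injective : ∀ a b {x y} → transpose a b x ≡ transpose a b y → x ≡ y
  transpose-injective a b {x} {y} e =
    ≡.trans (≡.sym (transpose-involutive a b x)) (≡.trans (≡.cong (transpose a b) e) (transpose-involutive a b y))

  transpose↔ : ℕ → ℕ → ℕ ↔ ℕ
  transpose↔ a b = mk↔ₛ′ (transpose a b) (transpose a b) (transpose-involutive a b) (transpose-involutive a b)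

module Exchangeability (K : CommutativeRing 0ℓ 0ℓ) {A : Over.UAlg K} {φ : Over.UFunctional K A}
                       (E : Over.ExchSystem K A φ) where
  open Over K using (module UAlg; module UFunctional)
  open Over.ExchSystem E
  open Transposition
  private module U = UAlg U
  module K = CommutativeRing K

  moment : ∀ {n} → (Fin n → UAlg.Carrier A) → (Fin n → ℕ) → K.Carrier
  moment X κ = φ̃′ (U.prod (tabulate λ p → X p ^⟨ κ p ⟩))

  SameKernel : ∀ {n} → (Fin n → ℕ) → (Fin n → ℕ) → Set
  SameKernel κ κ′ = ∀ p q → κ p ≡ κ q ⇔ κ′ p ≡ κ′ q

  moment-kernel : ∀ {n} (X : Fin n → UAlg.Carrier A) {κ κ′ : Fin n → ℕ} → SameKernel κ κ′ → moment X κ K.≈ moment X κ′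
  moment-kernel {n} X {κ} {κ′} same = fixFrom (allFin n) κ same (λ p p∉ → ⊥-elim (p∉ (∈-allFin p)))
    where
    -- positions outside ps already carry their final index; transpose at each remaining one
    fixFrom : (ps : List (Fin n)) (κ : Fin n → ℕ) → SameKernel κ κ′ → (∀ p → ¬ (p ∈ ps) → κ p ≡ κ′ p) →
      moment X κ K.≈ moment X κ′
    fixFrom [] κ same agree = UFunctional.φ-cong φ̃ (U.reflexive (≡.cong U.prod (List.tabulate-cong λ p →
      ≡.cong (X p ^⟨_⟩) (agree p λ ()))))
    fixFrom (p₀ ∷ ps) κ same agree = K.trans (exchangeable n X κ (transpose↔ a b)) (fixFrom ps κ₂ same₂ agree₂)
      where
      a b : ℕ
      a = κ p₀
      b = κ′ p₀
      κ₂ : Fin n → ℕ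
      κ₂ p = transpose a b (κ p)
      same₂ : SameKernel κ₂ κ′
      same₂ p q = ⇔.trans (mk⇔ (transpose-injective a b) (≡.cong (transpose a b))) (same p q)
      agree₂ : ∀ p → ¬ (p ∈ ps) → κ₂ p ≡ κ′ p
      agree₂ p p∉ps with p Fin.≟ p₀
      ... | yes ≡.refl = transpose-a a b
      ... | no p≢p₀    = unmoved (agree p λ { (here p≡p₀) → p≢p₀ p≡p₀ ; (there p∈ps) → p∉ps p∈ps })
        where
        unmoved : κ p ≡ κ′ p → transpose a b (κ p) ≡ κ′ p
        unmoved κp≡κ′p with κ′ p ℕ.≟ a | κ′ p ℕ.≟ b
        ... | yes κ′p≡a | _         = ≡.trans (≡.cong (transpose a b) (≡.trans κp≡κ′p κ′p≡a))
                                        (≡.trans (transpose-a a b) (≡.sym (Equivalence.to (same p p₀) (≡.trans κp≡κ′p κ′p≡a))))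
        ... | no κ′p≢a  | yes κ′p≡b = ⊥-elim (κ′p≢a (≡.trans (≡.sym κp≡κ′p) (Equivalence.from (same p p₀) κ′p≡b)))
        ... | no κ′p≢a  | no κ′p≢b  = ≡.trans (≡.cong (transpose a b) κp≡κ′p) (transpose-other a b (κ′ p) κ′p≢a κ′p≢b)

module Flattening (K : CommutativeRing 0ℓ 0ℓ) {A : Over.UAlg K} {φ : Over.UFunctional K A}
                  (E : Over.ExchSystem K A φ) (m : ℕ) (ns : Fin m → ℕ)
                  (X : (i : Fin m) → Fin (ns i) → Over.UAlg.Carrier A) where
  open Over K using (module UAlg)
  open Over.ExchSystem E
  open Over.Flatten K A m ns X
  open Expansion K using (embedding-prod; prod-concat; prod-tabulate-cong)
  private module U = UAlg U

  rowRepresentative : (∀ i → 1 ≤ ns i) → ∀ i → ∃ λ p → interval p ≡ i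
  rowRepresentative ns≥1 i = index i∈ , ≡.sym (≡.cong proj₁ (lookup-index i∈))
    where
    j₀ : Fin (ns i)
    j₀ = Fin.fromℕ< (ns≥1 i)
    i∈ : (i , X i j₀) ∈ pairs
    i∈ = ∈-concat⁺′ (∈-tabulate⁺ j₀) (∈-map⁺ (λ i → tabulate (λ j → (i , X i j))) (∈-allFin i))

  prod-rowProd : (e : Fin m → ℕ) →
    U.prod (tabulate λ i → rowProd i ^⟨ e i ⟩) U.≈ U.prod (tabulate λ p → Xflat p ^⟨ e (interval p) ⟩)
  prod-rowProd e = begin
    U.prod (tabulate λ i → rowProd i ^⟨ e i ⟩)
      ≈⟨ prod-tabulate-cong U (λ i → U.trans (embedding-prod (ι (e i)) (tabulate (X i)))
           (U.reflexive (≡.cong U.prod (≡.trans (List.map-tabulate (X i) (_^⟨ e i ⟩)) (≡.sym (List.map-tabulate _ lift)))))) ⟩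
    U.prod (tabulate λ i → U.prod (map lift (row i)))
      ≡⟨ ≡.cong U.prod (≡.sym (List.map-tabulate id (U.prod ∘ map lift ∘ row))) ⟩
    U.prod (map (U.prod ∘ map lift ∘ row) (allFin m))
      ≡⟨ ≡.cong U.prod (List.map-∘ (allFin m)) ⟩
    U.prod (map U.prod (map (map lift ∘ row) (allFin m)))
      ≈⟨ prod-concat U (map (map lift ∘ row) (allFin m)) ⟨
    U.prod (List.concat (map (map lift ∘ row) (allFin m)))
      ≡⟨ ≡.cong U.prod (≡.sym (List.map-concatMap lift row (allFin m))) ⟩
    U.prod (map lift pairs)
      ≡⟨ ≡.cong U.prod (≡.trans (≡.cong (map lift) (≡.sym (List.tabulate-lookup pairs))) (List.map-tabulate (List.lookup pairs) lift)) ⟩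
    U.prod (tabulate λ p → Xflat p ^⟨ e (interval p) ⟩) ∎
    where
    open import Relation.Binary.Reasoning.Setoid U.setoid
    row : Fin m → List (Fin m × UAlg.Carrier A)
    row i = tabulate (λ j → (i , X i j))
    lift : Fin m × UAlg.Carrier A → U.Carrier
    lift (i , x) = x ^⟨ e i ⟩

module CumulantOfProducts (K : CommutativeRing 0ℓ 0ℓ) (fc : Over.IsFieldChar0 K)
                   (A : Over.UAlg K) (φ : Over.UFunctional K A) (E : Over.ExchSystem K A φ)
                   (m′ : ℕ) (ω : CommutativeRing.Carrier K) (ω-prim : Over.PrimitiveRoot K (suc m′) ω)
                   (minv : CommutativeRing.Carrier K)
                   (m*minv≈1 : CommutativeRing._≈_ K (CommutativeRing._*_ K (Over.natK K (suc m′)) minv) (CommutativeRing.1# K))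
                   (ns : Fin (suc m′) → ℕ) (ns≥1 : ∀ i → 1 ≤ ns i)
                   (X : (i : Fin (suc m′)) → Fin (ns i) → Over.UAlg.Carrier A) where
  open Over K
  open CommutativeRing K hiding (zero)
  open RingSum ring
  open PartitionSums ring
  open Labellings
  open Flatten A (suc m′) ns X
  open Flattening K E (suc m′) ns X
  open Exchangeability K E
  open ExchSystem E
  open RootsOfUnity K
  open import Algebra.Properties.CommutativeSemigroup *-commutativeSemigroup using (x∙yz≈y∙xz)
  open Weights {m′} ω (proj₁ ω-prim)
  open Indecomposability fc ω ω-prim interval (proj₁ ∘ rowRepresentative ns≥1) (proj₂ ∘ rowRepresentative ns≥1)
  open import Relation.Binary.Reasoning.Setoid setoid

  coefficient : Labelling n n → Carrier
  coefficient τ = minv * ∑[ k ∈ allFuns M M ] when (τ ∼? (k ∘ interval)) (weight k)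

  private module U = UAlg U

  φX : Labelling n n → Carrier
  φX τ = φPart τ Xflat

  φX-resp-≗ : φX Preserves _≗_ ⟶ _≈_
  φX-resp-≗ σ≗σ′ = UFunctional.φ-cong φ̃ (U.reflexive (≡.cong U.prod (List.tabulate-cong λ p →
    ≡.cong (λ z → Xflat p ^⟨ toℕ z ⟩) (σ≗σ′ p))))

  cumulant-∑-moment : cumulant M ω minv rowProd ≈
    minv * ∑[ k ∈ allFuns M M ] (weight k * moment Xflat (λ p → suc (toℕ (k (interval p)))))
  cumulant-∑-moment = *-cong refl (begin
    φ̃′ (U.prod (tabulate λ j → U.sum (map (λ e → powK ω e U.· (rowProd j ^⟨ e ⟩)) (map suc (List.upTo M)))))
      ≡⟨ ≡.cong (φ̃′ ∘ U.prod) (List.tabulate-cong λ j → ≡.cong U.sum (≡.trans (≡.sym (List.map-∘ {g = F j} (List.upTo M)))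
           (≡.trans (≡.cong (map (F j ∘ suc)) (applyUpTo≡map-allFin id M)) (≡.sym (List.map-∘ {g = F j ∘ suc} (allFin M)))))) ⟩
    φ̃′ (U.prod (tabulate λ j → RingSum.∑ U.ring (allFin M) (λ c → coeff c U.· Z j c)))
      ≈⟨ UFunctional.φ-cong φ̃ (Expansion.prod-∑ K U M coeff Z) ⟩
    φ̃′ (RingSum.∑ U.ring (allFuns M M) (λ k → weight k U.· U.prod (tabulate λ j → Z j (k j))))
      ≈⟨ Expansion.φ-linear K φ̃ (allFuns M M) weight _ ⟩
    ∑[ k ∈ allFuns M M ] (weight k * φ̃′ (U.prod (tabulate λ j → Z j (k j))))
      ≈⟨ ∑-cong (allFuns M M) (λ k → *-cong refl (UFunctional.φ-cong φ̃ (prod-rowProd (λ j → suc (toℕ (k j)))))) ⟩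
    ∑[ k ∈ allFuns M M ] (weight k * moment Xflat (λ p → suc (toℕ (k (interval p))))) ∎)
    where
    F : Fin M → ℕ → U.Carrier
    F j e = powK ω e U.· (rowProd j ^⟨ e ⟩)
    Z : Fin M → Fin M → U.Carrier
    Z j c = rowProd j ^⟨ suc (toℕ c) ⟩

  moment≈φX-canon : (k : Labelling M M) → moment Xflat (λ p → suc (toℕ (k (interval p)))) ≈ φX (canon (k ∘ interval))
  moment≈φX-canon k = moment-kernel Xflat λ p q → mk⇔
    (λ e → ≡.cong toℕ (κ≼canon (k ∘ interval) p q (Fin.toℕ-injective (ℕ.suc-injective e))))
    (λ e → ≡.cong (suc ∘ toℕ) (proj₁ (canon∼ (k ∘ interval)) p q (Fin.toℕ-injective e)))

  cumulant-expansion : cumulant M ω minv rowProd ≈ ∑[ τ ∈ Π n ] (φX τ * coefficient τ)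
  cumulant-expansion = begin
    cumulant M ω minv rowProd
      ≈⟨ cumulant-∑-moment ⟩
    minv * ∑[ k ∈ allFuns M M ] (weight k * moment Xflat (λ p → suc (toℕ (k (interval p)))))
      ≈⟨ *-cong refl (∑-cong (allFuns M M) λ k → *-cong refl
           (trans (moment≈φX-canon k) (sym (∑-Π-kernel (k ∘ interval) φX φX-resp-≗)))) ⟩
    minv * ∑[ k ∈ allFuns M M ] (weight k * ∑[ τ ∈ Π n ] when (τ ∼? (k ∘ interval)) (φX τ))
      ≈⟨ *-cong refl (∑-cong (allFuns M M) λ k → ∑-distribˡ (Π n) _ _) ⟩
    minv * ∑[ k ∈ allFuns M M ] ∑[ τ ∈ Π n ] (weight k * when (τ ∼? (k ∘ interval)) (φX τ))
      ≈⟨ *-cong refl (∑-comm (allFuns M M) (Π n) _) ⟩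
    minv * ∑[ τ ∈ Π n ] ∑[ k ∈ allFuns M M ] (weight k * when (τ ∼? (k ∘ interval)) (φX τ))
      ≈⟨ *-cong refl (∑-cong (Π n) λ τ → trans (∑-cong (allFuns M M) λ k → swap (τ ∼? (k ∘ interval)))
           (sym (∑-distribˡ (allFuns M M) _ _))) ⟩
    minv * ∑[ τ ∈ Π n ] (φX τ * ∑[ k ∈ allFuns M M ] when (τ ∼? (k ∘ interval)) (weight k))
      ≈⟨ trans (∑-distribˡ (Π n) _ _) (∑-cong (Π n) λ τ → x∙yz≈y∙xz _ _ _) ⟩
    ∑[ τ ∈ Π n ] (φX τ * coefficient τ) ∎
    where
    swap : ∀ {p} {Q : Set p} (d : Dec Q) {w x} → w * when d x ≈ x * when d w
    swap d = trans (when-*ˡ d _ _) (trans (when-cong d λ _ → *-comm _ _) (sym (when-*ˡ d _ _)))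

  coefficient-resp-≗ : coefficient Preserves _≗_ ⟶ _≈_
  coefficient-resp-≗ {τ} {τ′} τ≗τ′ = *-cong refl (∑-cong (allFuns M M) λ k →
    when-⇔ (τ ∼? (k ∘ interval)) (τ′ ∼? (k ∘ interval)) _ (∼-respˡ-∼ (≗⇒∼ τ≗τ′)))

  ∑-up-coefficient : ∀ σ → ∑ (filter (σ ≼?_) (Π n)) coefficient ≈ when (Indecomposable? σ) 1#
  ∑-up-coefficient σ = begin
    ∑ (filter (σ ≼?_) (Π n)) coefficient
      ≈⟨ ∑-filter (σ ≼?_) (Π n) coefficient ⟩
    ∑[ ρ ∈ Π n ] when (σ ≼? ρ) (minv * ∑[ k ∈ allFuns M M ] when (ρ ∼? (k ∘ interval)) (weight k))
      ≈⟨ ∑-cong (Π n) (λ ρ → trans (sym (when-*ˡ (σ ≼? ρ) _ _)) (*-cong refl (sym (∑-when (σ ≼? ρ) (allFuns M M) _)))) ⟩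
    ∑[ ρ ∈ Π n ] (minv * ∑[ k ∈ allFuns M M ] when (σ ≼? ρ) (when (ρ ∼? (k ∘ interval)) (weight k)))
      ≈⟨ ∑-distribˡ (Π n) _ _ ⟨
    minv * ∑[ ρ ∈ Π n ] ∑[ k ∈ allFuns M M ] when (σ ≼? ρ) (when (ρ ∼? (k ∘ interval)) (weight k))
      ≈⟨ *-cong refl (∑-comm (Π n) (allFuns M M) _) ⟩
    minv * ∑[ k ∈ allFuns M M ] ∑[ ρ ∈ Π n ] when (σ ≼? ρ) (when (ρ ∼? (k ∘ interval)) (weight k))
      ≈⟨ *-cong refl (∑-cong (allFuns M M) λ k → trans (∑-cong (Π n) λ ρ → when-comm (σ ≼? ρ) (ρ ∼? (k ∘ interval)) (weight k))
           (∑-Π-kernel (k ∘ interval) (λ ρ → when (σ ≼? ρ) (weight k)) λ {ρ} {ρ′} ρ≗ρ′ →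
             when-⇔ (σ ≼? ρ) (σ ≼? ρ′) _ (≼-respʳ-∼ (≗⇒∼ ρ≗ρ′)))) ⟩
    minv * ∑[ k ∈ allFuns M M ] when (σ ≼? canon (k ∘ interval)) (weight k)
      ≈⟨ *-cong refl (∑-cong (allFuns M M) λ k →
           when-⇔ (σ ≼? canon (k ∘ interval)) (σ ≼? (k ∘ interval)) _ (≼-respʳ-∼ (canon∼ (k ∘ interval)))) ⟩
    minv * ∑ (allFuns M M) (weightIf σ)
      ≈⟨ *-cong refl (∑-weightIf σ) ⟩
    minv * when (Indecomposable? σ) (natK M)
      ≈⟨ when-*ˡ (Indecomposable? σ) _ _ ⟩
    when (Indecomposable? σ) (minv * natK M)
      ≈⟨ when-cong (Indecomposable? σ) (λ _ → trans (*-comm _ _) m*minv≈1) ⟩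
    when (Indecomposable? σ) 1# ∎

proposition3p3 : (K : CommutativeRing 0ℓ 0ℓ) → let open Over K in
    IsFieldChar0 →
    (A : UAlg) (φ : UFunctional A) (E : ExchSystem A φ) →
    (m : ℕ) → 1 ≤ m →
    (ω : K.Carrier) → PrimitiveRoot m ω →
    (minv : K.Carrier) → natK m K.* minv K.≈ K.1# →
    (ns : Fin m → ℕ) → (∀ i → 1 ≤ ns i) →
    (X : (i : Fin m) → Fin (ns i) → UAlg.Carrier A) →
    let open Flatten A m ns X in
    ExchSystem.cumulant E m ω minv rowProd
      K.≈ sumK (map (λ σ → Kpart E σ Xflat) (filter Indecomposable? (Π n)))
proposition3p3 K fc A φ E (suc m′) _ ω ω-prim minv m*minv≈1 ns ns≥1 X = begin
  cumulant (suc m′) ω minv rowProd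
    ≈⟨ cumulant-expansion ⟩
  ∑[ τ ∈ Π n ] (φX τ * coefficient τ)
    ≈⟨ möbius-inversion φX coefficient coefficient-resp-≗ ⟨
  ∑[ σ ∈ Π n ] (∑ (filter (σ ≼?_) (Π n)) coefficient * Kpart E σ Xflat)
    ≈⟨ ∑-cong (Π n) (λ σ → trans (*-cong (∑-up-coefficient σ) refl)
         (trans (when-*ʳ (Indecomposable? σ) _ _) (when-cong (Indecomposable? σ) λ _ → *-identityˡ _))) ⟩
  ∑[ σ ∈ Π n ] when (Indecomposable? σ) (Kpart E σ Xflat)
    ≈⟨ ∑-filter Indecomposable? (Π n) _ ⟨
  sumK (map (λ σ → Kpart E σ Xflat) (filter Indecomposable? (Π n))) ∎
  where
  open Over K
  open CommutativeRing K
  open RingSum ring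
  open Möbius K using (möbius-inversion)
  open ExchSystem E using (cumulant)
  open Flatten A (suc m′) ns X
  open CumulantOfProducts K fc A φ E m′ ω ω-prim minv m*minv≈1 ns ns≥1 X
  open import Relation.Binary.Reasoning.Setoid setoid
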